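{- Let $\mathsf{P}$ be a finite graded poset of rank $r$. Then $\nabla\circ\mathrm{row}_{\mathcal{F}}=\mathrm{row}_{\mathcal{A}}\circ\nabla$, $\nabla\circ\mathrm{rvac}_{\mathcal{F}}=\mathrm{rvac}_{\mathcal{A}}\circ\nabla$, and $(\Delta\circ\Theta)\circ\mathrm{rvac}^*_{\mathcal{F}}=\mathrm{rvac}^*_{\mathcal{A}}\circ(\Delta\circ\Theta)$ as maps from order filters of $\mathsf{P}$ to antichains of $\mathsf{P}$; moreover $\Delta\circ\Theta=\mathrm{row}_{\mathcal{A}}^{ -1}\circ\nabla$. Consequently, $\mathrm{rvac}_{\mathcal{A}}$ and $\mathrm{rvac}^*_{\mathcal{A}}$ are involutions on $\mathcal{A}(\mathsf{P})$, $\mathrm{rvac}_{\mathcal{A}}\circ\mathrm{row}_{\mathcal{A}}=\mathrm{row}_{\mathcal{A}}^{ -1}\circ\mathrm{rvac}_{\mathcal{A}}$, and $\mathrm{rvac}^*_{\mathcal{A}}\circ\mathrm{row}_{\mathcal{A}}=\mathrm{row}_{\mathcal{A}}^{ -1}\circ\mathrm{rvac}^*_{\mathcal{A}}$.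
   Context: $\mathsf{P}$ is graded of rank $r$: there is $\mathrm{rk}\colon\mathsf{P}\to\mathbb{Z}_{\ge0}$ with minimal elements of rank $0$, maximal elements of rank $r$, and $\mathrm{rk}$ increasing by $1$ along covers; $\mathsf{P}_i$ is the set of rank-$i$ elements. $\mathcal{A}(\mathsf{P})$, $\mathcal{F}(\mathsf{P})$, $\mathcal{J}(\mathsf{P})$ are the sets of antichains, order filters, order ideals. $\Theta(S)=\mathsf{P}\setminus S$ (swapping order ideals and order filters); $\Delta\colon\mathcal{J}(\mathsf{P})\to\mathcal{A}(\mathsf{P})$ sends an order ideal to its set of maximal elements; $\nabla\colon\mathcal{F}(\mathsf{P})\to\mathcal{A}(\mathsf{P})$ sends an order filter to its set of minimal elements. $\mathrm{row}_{\mathcal{F}}=\Theta\circ\Delta^{ -1}\circ\nabla$ and $\mathrm{row}_{\mathcal{A}}=\nabla\circ\Theta\circ\Delta^{ -1}$. Order filter toggle $t_p$: adds $p$ to $F$ if $p\notin F$ and the result is an order filter, removes $p$ if $p\in F$ and the result is an order filter, otherwise does nothing. Antichain toggle $\tau_p$: $\tau_p(A)=A\cup\{p\}$ if $p\notin A$ and $A\cup\{p\}$ is an antichain, $\tau_p(A)=A\setminus\{p\}$ if $p\in A$, else $A$. Rank toggles $\mathbf{t}_i=\prod_{p\in\mathsf{P}_i}t_p$, $\boldsymbol{\tau}_i=\prod_{p\in\mathsf{P}_i}\tau_p$. Products of maps are compositions, rightmost first. It is known that $\mathrm{row}_{\mathcal{F}}=\mathbf{t}_0\cdots\mathbf{t}_r$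 and $\mathrm{row}_{\mathcal{A}}=\boldsymbol{\tau}_r\cdots\boldsymbol{\tau}_0$. Define $\mathrm{rvac}_{\mathcal{F}}=(\mathbf{t}_r)(\mathbf{t}_{r-1}\mathbf{t}_r)\cdots(\mathbf{t}_1\cdots\mathbf{t}_r)(\mathbf{t}_0\mathbf{t}_1\cdots\mathbf{t}_r)$, $\mathrm{rvac}^*_{\mathcal{F}}=(\mathbf{t}_0)(\mathbf{t}_1\mathbf{t}_0)\cdots(\mathbf{t}_{r-1}\cdots\mathbf{t}_0)(\mathbf{t}_r\cdots\mathbf{t}_0)$, $\mathrm{rvac}_{\mathcal{A}}=(\boldsymbol{\tau}_r)(\boldsymbol{\tau}_r\boldsymbol{\tau}_{r-1})\cdots(\boldsymbol{\tau}_r\cdots\boldsymbol{\tau}_1)(\boldsymbol{\tau}_r\cdots\boldsymbol{\tau}_1\boldsymbol{\tau}_0)$, $\mathrm{rvac}^*_{\mathcal{A}}=(\boldsymbol{\tau}_0)(\boldsymbol{\tau}_0\boldsymbol{\tau}_1)\cdots(\boldsymbol{\tau}_0\cdots\boldsymbol{\tau}_{r-1})(\boldsymbol{\tau}_0\cdots\boldsymbol{\tau}_r)$. -}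

module Defs where

open import Data.Nat using (ℕ; zero; suc; _+_; _∸_)
open import Data.Nat.Properties using () renaming (_≟_ to _≟ℕ_)
open import Data.Bool using (Bool; true; false; if_then_else_)
open import Data.Fin using (Fin; _≟_)
open import Data.Fin.Subset using (Subset; _∈_; _∉_; ∁; inside; outside)
open import Data.Fin.Subset.Properties using (_∈?_)
open import Data.Fin.Properties using (all?; any?)
open import Data.List using (List; []; _∷_; map; foldr; filter; upTo; reverse)
open import Data.List.Base using (allFin)
open import Data.Vec using (tabulate; _[_]≔_)
open import Data.Product using (_×_; ∃)
open import Function using (_∘_; id)
open import Relation.Binary.PropositionalEquality using (_≡_)
open import Relation.Binary.Structures using (IsPartialOrder)
open import Relation.Binary.Definitions using (Decidable)
open import Relation.Nullary using (Dec; does; ¬_; _×-dec_; _→-dec_)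

record FinitePoset (n : ℕ) : Set₁ where
  field
    _≼_            : Fin n → Fin n → Set
    isPartialOrder : IsPartialOrder _≡_ _≼_
    _≼?_           : Decidable _≼_

module _ {n : ℕ} (P : FinitePoset n) where
  open FinitePoset P

  _≺_ : Fin n → Fin n → Set
  x ≺ y = x ≼ y × ¬ (x ≡ y)

  _⋖_ : Fin n → Fin n → Set
  x ⋖ y = x ≺ y × (∀ z → x ≺ z → ¬ (z ≺ y))

  IsMinimal : Fin n → Set
  IsMinimal x = ∀ y → y ≼ x → y ≡ x

  IsMaximal : Fin n → Set
  IsMaximal x = ∀ y → x ≼ y → y ≡ x

  record IsGraded (r : ℕ) (rk : Fin n → ℕ) : Set where
    field
      minimal-rank : ∀ x → IsMinimal x → rk x ≡ 0
      maximal-rank : ∀ x → IsMaximal x → rk x ≡ r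
      cover-rank   : ∀ x y → x ⋖ y → rk y ≡ suc (rk x)

  IsFilter : Subset n → Set
  IsFilter S = ∀ x y → x ∈ S → x ≼ y → y ∈ S

  IsIdeal : Subset n → Set
  IsIdeal S = ∀ x y → y ∈ S → x ≼ y → x ∈ S

  IsAntichain : Subset n → Set
  IsAntichain A = ∀ x y → x ∈ A → y ∈ A → x ≼ y → x ≡ y

  isFilter? : (S : Subset n) → Dec (IsFilter S)
  isFilter? S = all? λ x → all? λ y → (x ∈? S) →-dec ((x ≼? y) →-dec (y ∈? S))

  isAntichain? : (A : Subset n) → Dec (IsAntichain A)
  isAntichain? A = all? λ x → all? λ y →
    (x ∈? A) →-dec ((y ∈? A) →-dec ((x ≼? y) →-dec (x ≟ y)))

  Θ : Subset n → Subset n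
  Θ = ∁

  Δ : Subset n → Subset n
  Δ I = tabulate λ x → does ((x ∈? I) ×-dec
          all? λ y → (y ∈? I) →-dec ((x ≼? y) →-dec (y ≟ x)))

  Δ⁻¹ : Subset n → Subset n
  Δ⁻¹ A = tabulate λ x → does (any? λ a → (a ∈? A) ×-dec (x ≼? a))

  ∇ : Subset n → Subset n
  ∇ F = tabulate λ x → does ((x ∈? F) ×-dec
          all? λ y → (y ∈? F) →-dec ((y ≼? x) →-dec (y ≟ x)))

  ∇⁻¹ : Subset n → Subset n
  ∇⁻¹ A = tabulate λ x → does (any? λ a → (a ∈? A) ×-dec (a ≼? x))

  rowF : Subset n → Subset n
  rowF = Θ ∘ Δ⁻¹ ∘ ∇

  rowA : Subset n → Subset n
  rowA = ∇ ∘ Θ ∘ Δ⁻¹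

  -- the inverse of rowA = ∇ ∘ Θ ∘ Δ⁻¹, factor by factor
  rowA⁻¹ : Subset n → Subset n
  rowA⁻¹ = Δ ∘ Θ ∘ ∇⁻¹

  t : Fin n → Subset n → Subset n
  t p S with does (p ∈? S)
  ... | true  = if does (isFilter? (S [ p ]≔ outside)) then S [ p ]≔ outside else S
  ... | false = if does (isFilter? (S [ p ]≔ inside))  then S [ p ]≔ inside  else S

  τ : Fin n → Subset n → Subset n
  τ p A with does (p ∈? A)
  ... | true  = A [ p ]≔ outside
  ... | false = if does (isAntichain? (A [ p ]≔ inside)) then A [ p ]≔ inside else A

-- composition of a list of maps, leftmost outermost: compose [f , g] = f ∘ g
compose : {A : Set} → List (A → A) → A → A
compose = foldr (λ f g → f ∘ g) id

-- [ a ⋯ b ] = a ∷ a+1 ∷ … ∷ b  (empty if b < a)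
[_⋯_] : ℕ → ℕ → List ℕ
[ a ⋯ b ] = map (a +_) (upTo (suc b ∸ a))

[_⋯↓_] : ℕ → ℕ → List ℕ
[ b ⋯↓ a ] = reverse [ a ⋯ b ]

module _ {n : ℕ} (P : FinitePoset n) (rk : Fin n → ℕ) where

  rankList : ℕ → List (Fin n)
  rankList i = filter (λ p → rk p ≟ℕ i) (allFin n)

  𝐭 : ℕ → Subset n → Subset n
  𝐭 i = compose (map (t P) (rankList i))

  𝛕 : ℕ → Subset n → Subset n
  𝛕 i = compose (map (τ P) (rankList i))

  module _ (r : ℕ) where
    -- (𝐭_r)(𝐭_{r-1} 𝐭_r)⋯(𝐭_0 ⋯ 𝐭_r)
    rvacF : Subset n → Subset n
    rvacF = compose (map (λ k → compose (map 𝐭 [ k ⋯ r ])) [ r ⋯↓ 0 ])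

    -- (𝐭_0)(𝐭_1 𝐭_0)⋯(𝐭_r ⋯ 𝐭_0)
    rvacF* : Subset n → Subset n
    rvacF* = compose (map (λ k → compose (map 𝐭 [ k ⋯↓ 0 ])) [ 0 ⋯ r ])

    -- (𝛕_r)(𝛕_r 𝛕_{r-1})⋯(𝛕_r ⋯ 𝛕_0)
    rvacA : Subset n → Subset n
    rvacA = compose (map (λ k → compose (map 𝛕 [ r ⋯↓ k ])) [ r ⋯↓ 0 ])

    -- (𝛕_0)(𝛕_0 𝛕_1)⋯(𝛕_0 ⋯ 𝛕_r)
    rvacA* : Subset n → Subset n
    rvacA* = compose (map (λ k → compose (map 𝛕 [ 0 ⋯ k ])) [ 0 ⋯ r ])

-- Antichains and order filters correspond through ∇ (minimal elements) and through Δ ∘ Θ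
-- (maximal elements of the complement). The heart of the proof is that ∇ turns the partial
-- product 𝐭_k ⋯ 𝐭_r of filter rank toggles into 𝛕_r ⋯ 𝛕_k, and Δ ∘ Θ turns 𝐭_k ⋯ 𝐭_0 into
-- 𝛕_0 ⋯ 𝛕_k: toggling a filter F from the top rank down to rank k leaves F below rank k and
-- makes it agree with row_F(F) from rank k on, and toggling the antichain ∇F upwards from
-- rank k rebuilds the minimal elements of that filter one rank at a time. The rank toggles
-- 𝐭_i are involutions that commute when |i − j| ≥ 2, which suffices to show abstractly that
-- rvac and rvac* are involutions conjugating row to row⁻¹; transporting along ∇ and Δ ∘ Θ
-- gives the statements about antichains.

module Submission where

open import Defs
open import Data.Nat as ℕ using (ℕ; zero; suc; _+_; _∸_; _<_; _≤_; z≤n; s≤s; _≤?_)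
import Data.Nat.Properties as ℕ
open import Data.Nat.Properties using () renaming (_≟_ to _≟ℕ_)
open import Data.Bool using (Bool; true; if_then_else_)
open import Data.Fin using (Fin; _≟_)
open import Data.Fin.Induction using (spo-wellFounded)
open import Data.Fin.Subset using (Subset; _∈_; _∉_; ∁; inside; outside)
open import Data.Fin.Subset.Properties using (_∈?_; ⊆-antisym; x∈p⇒x∉∁p; x∈∁p⇒x∉p; x∉p⇒x∈∁p; x∉∁p⇒x∈p)
open import Data.Fin.Properties using (all?; any?)
open import Data.Vec using (lookup; tabulate; _[_]≔_)
open import Data.Vec.Properties using ([]=⇒lookup; lookup⇒[]=; lookup∘tabulate; []≔-updates; []=-injective; lookup∘update′)
open import Data.List using (List; []; _∷_; [_]; _++_; _∷ʳ_; map; reverse; upTo; applyUpTo; allFin)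
import Data.List.Properties as ListP
open import Data.List.Membership.Propositional using () renaming (_∈_ to _∈ₗ_; _∉_ to _∉ₗ_)
open import Data.List.Membership.Propositional.Properties using (∈-filter⁺; ∈-filter⁻; ∈-allFin; ∈-map⁻; ∈-upTo⁻)
open import Data.List.Relation.Unary.Any.Properties using (reverse⁻)
open import Data.List.Relation.Unary.Any using (here; there)
open import Data.List.Relation.Unary.All as All using (All; []; _∷_)
open import Data.List.Relation.Unary.Unique.Propositional using (Unique)
import Data.List.Relation.Unary.AllPairs as AllPairs
import Data.List.Relation.Unary.Unique.Propositional.Properties as Unique
open import Data.Product using (∃-syntax; _×_; _,_; proj₁; proj₂)
open import Data.Sum using (_⊎_; inj₁; inj₂; [_,_]′)
open import Data.Unit using (⊤; tt)
open import Data.Empty using (⊥-elim)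
open import Function using (_∘_; flip; _⇔_; mk⇔; Equivalence)
open import Induction.WellFounded using (WellFounded; Acc; acc)
open import Relation.Binary.PropositionalEquality using (_≡_; _≢_; refl; sym; trans; cong; cong₂; subst; module ≡-Reasoning)
open import Relation.Nullary using (Dec; yes; no; does; ¬_; ¬?; _×-dec_; _→-dec_)
open import Relation.Binary.Structures using (IsPartialOrder)
import Relation.Binary.Reasoning.Setoid as SetoidReasoning
open import Level using (0ℓ)
import Relation.Binary.Construct.NonStrictToStrict as NonStrictToStrict
import Relation.Binary.Construct.Flip.EqAndOrd as Flip

open Equivalence using (to; from)
import Function.Properties.Equivalence as ⇔
module ⇔-Reasoning = SetoidReasoning (⇔.⇔-setoid 0ℓ)

if-does : {X : Set} (R : X → Set) {Q : Set} (Q? : Dec Q) {x y : X} →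
          (Q → R x) → (¬ Q → R y) → R (if does Q? then x else y)
if-does R (yes q) yes-case _ = yes-case q
if-does R (no ¬q) _ no-case = no-case ¬q

module _ {n : ℕ} where

  Subset-≡ : {S T : Subset n} → (∀ x → x ∈ S ⇔ x ∈ T) → S ≡ T
  Subset-≡ S⇔T = ⊆-antisym (to (S⇔T _)) (from (S⇔T _))

  ∈-tabulate-does : {Q : Fin n → Set} (Q? : ∀ x → Dec (Q x)) {x : Fin n} →
                    x ∈ tabulate (λ y → does (Q? y)) ⇔ Q x
  ∈-tabulate-does {Q} Q? {x} = mk⇔
      (λ x∈ → witness (Q? x) (trans (sym lookup-x) ([]=⇒lookup x∈)))
      (λ q → lookup⇒[]= x _ (trans lookup-x (yes-does (Q? x) q)))
    where
      lookup-x = lookup∘tabulate (λ y → does (Q? y)) x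
      witness : (d : Dec (Q x)) → does d ≡ true → Q x
      witness (yes q) _ = q
      yes-does : (d : Dec (Q x)) → Q x → does d ≡ true
      yes-does (yes _) _ = refl
      yes-does (no ¬q) q = ⊥-elim (¬q q)

  ∈-∁ : {S : Subset n} {x : Fin n} → x ∈ ∁ S ⇔ x ∉ S
  ∈-∁ = mk⇔ x∈∁p⇒x∉p x∉p⇒x∈∁p

  ∁-involutive : (S : Subset n) → ∁ (∁ S) ≡ S
  ∁-involutive S = Subset-≡ λ x → mk⇔ (x∉∁p⇒x∈p ∘ x∈∁p⇒x∉p) (x∉p⇒x∈∁p ∘ x∈p⇒x∉∁p)

  x∈S[x]≔inside : (S : Subset n) (x : Fin n) → x ∈ S [ x ]≔ inside
  x∈S[x]≔inside = []≔-updates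

  x∉S[x]≔outside : (S : Subset n) (x : Fin n) → x ∉ S [ x ]≔ outside
  x∉S[x]≔outside S x x∈ with []=-injective ([]≔-updates S x) x∈
  ... | ()

  ∈-[]≔-other : {S : Subset n} {x p : Fin n} (b : Bool) → x ≢ p → x ∈ S [ p ]≔ b ⇔ x ∈ S
  ∈-[]≔-other {S} {x} b x≢p = mk⇔
    (λ x∈ → lookup⇒[]= x S (trans (sym (lookup∘update′ x≢p S b)) ([]=⇒lookup x∈)))
    (λ x∈ → lookup⇒[]= x _ (trans (lookup∘update′ x≢p S b) ([]=⇒lookup x∈)))

-- ∇ and ∇⁻¹ of the dual poset are definitionally Δ and Δ⁻¹, so facts about Δ come for free.
dual : {n : ℕ} → FinitePoset n → FinitePoset n
dual P = record
  { _≼_ = flip _≼_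
  ; isPartialOrder = Flip.isPartialOrder isPartialOrder
  ; _≼?_ = flip _≼?_
  }
  where open FinitePoset P

module Order {n : ℕ} (P : FinitePoset n) where
  open FinitePoset P public
  open IsPartialOrder isPartialOrder public using (antisym) renaming (refl to ≼-refl; trans to ≼-trans)
  open NonStrictToStrict _≡_ _≼_ using (<-isStrictPartialOrder; <-decidable)

  infix 4 _⊏_ _⊏?_

  _⊏_ : Fin n → Fin n → Set
  _⊏_ = _≺_ P

  _⊏?_ : ∀ x y → Dec (x ⊏ y)
  _⊏?_ = <-decidable _≟_ _≼?_

  ⊏-irrefl : ∀ {x} → ¬ x ⊏ x
  ⊏-irrefl (_ , x≢x) = x≢x refl

  ≼⇒≡⊎⊏ : ∀ {x y} → x ≼ y → x ≡ y ⊎ x ⊏ y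
  ≼⇒≡⊎⊏ {x} {y} x≼y with x ≟ y
  ... | yes x≡y = inj₁ x≡y
  ... | no x≢y = inj₂ (x≼y , x≢y)

  ⊏-wellFounded : WellFounded _⊏_
  ⊏-wellFounded = spo-wellFounded (<-isStrictPartialOrder isPartialOrder)

  IsMinimalIn : (Fin n → Set) → Fin n → Set
  IsMinimalIn Q m = Q m × (∀ y → Q y → y ≼ m → y ≡ m)

  minimal-below : {Q : Fin n → Set} → (∀ x → Dec (Q x)) →
                  ∀ {x} → Q x → ∃[ m ] m ≼ x × IsMinimalIn Q m
  minimal-below {Q} Q? {x} = go (⊏-wellFounded x)
    where
      go : ∀ {x} → Acc _⊏_ x → Q x → ∃[ m ] m ≼ x × IsMinimalIn Q m
      go {x} (acc below) qx with any? (λ y → Q? y ×-dec (y ⊏? x))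
      ... | yes (y , qy , y⊏x) =
        let m , m≼y , m-min = go (below y⊏x) qy in m , ≼-trans m≼y (proj₁ y⊏x) , m-min
      ... | no nothing-below = x , ≼-refl , qx , λ y qy y≼x → minimal y qy (≼⇒≡⊎⊏ y≼x)
        where
          minimal : ∀ y → Q y → y ≡ x ⊎ y ⊏ x → y ≡ x
          minimal y _ (inj₁ y≡x) = y≡x
          minimal y qy (inj₂ y⊏x) = ⊥-elim (nothing-below (y , qy , y⊏x))

  ∈-∇ : ∀ {F x} → x ∈ ∇ P F ⇔ IsMinimalIn (_∈ F) x
  ∈-∇ {F} = ∈-tabulate-does λ x → (x ∈? F) ×-dec all? λ y → (y ∈? F) →-dec ((y ≼? x) →-dec (y ≟ x))

  ∈-∇⁻¹ : ∀ {A x} → x ∈ ∇⁻¹ P A ⇔ (∃[ a ] a ∈ A × a ≼ x)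
  ∈-∇⁻¹ {A} = ∈-tabulate-does λ x → any? λ a → (a ∈? A) ×-dec (a ≼? x)

  ∇-antichain : ∀ F → IsAntichain P (∇ P F)
  ∇-antichain F x y x∈ y∈ x≼y = proj₂ (to ∈-∇ y∈) x (proj₁ (to ∈-∇ x∈)) x≼y

  ∇⁻¹-filter : ∀ A → IsFilter P (∇⁻¹ P A)
  ∇⁻¹-filter A x y x∈ x≼y =
    let a , a∈A , a≼x = to ∈-∇⁻¹ x∈ in from ∈-∇⁻¹ (a , a∈A , ≼-trans a≼x x≼y)

  ∇∘∇⁻¹ : ∀ A → IsAntichain P A → ∇ P (∇⁻¹ P A) ≡ A
  ∇∘∇⁻¹ A A-antichain = Subset-≡ λ x → mk⇔ (generator x) (minimal x)
    where
      generator : ∀ x → x ∈ ∇ P (∇⁻¹ P A) → x ∈ A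
      generator x x∈ =
        let x∈↑A , x-min = to ∈-∇ x∈
            a , a∈A , a≼x = to ∈-∇⁻¹ x∈↑A
        in subst (_∈ A) (x-min a (from ∈-∇⁻¹ (a , a∈A , ≼-refl)) a≼x) a∈A
      minimal : ∀ x → x ∈ A → x ∈ ∇ P (∇⁻¹ P A)
      minimal x x∈A = from ∈-∇ (from ∈-∇⁻¹ (x , x∈A , ≼-refl) , λ y y∈↑A y≼x →
        let a , a∈A , a≼y = to ∈-∇⁻¹ y∈↑A
        in antisym y≼x (subst (_≼ y) (A-antichain a x a∈A x∈A (≼-trans a≼y y≼x)) a≼y))

  ∇⁻¹∘∇ : ∀ F → IsFilter P F → ∇⁻¹ P (∇ P F) ≡ F
  ∇⁻¹∘∇ F F-filter = Subset-≡ λ x → mk⇔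
    (λ x∈ → let a , a∈∇F , a≼x = to ∈-∇⁻¹ x∈ in F-filter a x (proj₁ (to ∈-∇ a∈∇F)) a≼x)
    (λ x∈F → let m , m≼x , m-min = minimal-below (_∈? F) x∈F in from ∈-∇⁻¹ (m , from ∈-∇ m-min , m≼x))

module Poset {n : ℕ} (P : FinitePoset n) where
  open Order P public
  private module Dual = Order (dual P)

  IsMaximalIn : (Fin n → Set) → Fin n → Set
  IsMaximalIn Q m = Q m × (∀ y → Q y → m ≼ y → y ≡ m)

  maximal-above : {Q : Fin n → Set} → (∀ x → Dec (Q x)) →
                  ∀ {x} → Q x → ∃[ m ] x ≼ m × IsMaximalIn Q m
  maximal-above = Dual.minimal-below

  ∈-Δ : ∀ {I x} → x ∈ Δ P I ⇔ IsMaximalIn (_∈ I) x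
  ∈-Δ = Dual.∈-∇

  ∈-Δ⁻¹ : ∀ {A x} → x ∈ Δ⁻¹ P A ⇔ (∃[ a ] a ∈ A × x ≼ a)
  ∈-Δ⁻¹ = Dual.∈-∇⁻¹

  Δ-antichain : ∀ I → IsAntichain P (Δ P I)
  Δ-antichain I x y x∈ y∈ x≼y = sym (Dual.∇-antichain I y x y∈ x∈ x≼y)

  Δ⁻¹-ideal : ∀ A → IsIdeal P (Δ⁻¹ P A)
  Δ⁻¹-ideal A x y y∈ x≼y = Dual.∇⁻¹-filter A y x y∈ x≼y

  Δ∘Δ⁻¹ : ∀ A → IsAntichain P A → Δ P (Δ⁻¹ P A) ≡ A
  Δ∘Δ⁻¹ A A-antichain = Dual.∇∘∇⁻¹ A λ x y x∈ y∈ y≼x → sym (A-antichain y x y∈ x∈ y≼x)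

  Δ⁻¹∘Δ : ∀ I → IsIdeal P I → Δ⁻¹ P (Δ P I) ≡ I
  Δ⁻¹∘Δ I I-ideal = Dual.∇⁻¹∘∇ I λ x y x∈ y≼x → I-ideal y x x∈ y≼x

  Θ-ideal : ∀ {I} → IsIdeal P I → IsFilter P (Θ P I)
  Θ-ideal I-ideal x y x∈ x≼y = from ∈-∁ λ y∈I → to ∈-∁ x∈ (I-ideal x y y∈I x≼y)

  Θ-filter : ∀ {F} → IsFilter P F → IsIdeal P (Θ P F)
  Θ-filter F-filter x y y∈ x≼y = from ∈-∁ λ x∈F → to ∈-∁ y∈ (F-filter x y x∈F x≼y)

  rowA⁻¹∘rowA : ∀ A → IsAntichain P A → rowA⁻¹ P (rowA P A) ≡ A
  rowA⁻¹∘rowA A A-antichain = begin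
    Δ P (Θ P (∇⁻¹ P (∇ P (Θ P (Δ⁻¹ P A)))))  ≡⟨ cong (Δ P ∘ Θ P) (∇⁻¹∘∇ _ (Θ-ideal (Δ⁻¹-ideal A))) ⟩
    Δ P (Θ P (Θ P (Δ⁻¹ P A)))                ≡⟨ cong (Δ P) (∁-involutive _) ⟩
    Δ P (Δ⁻¹ P A)                            ≡⟨ Δ∘Δ⁻¹ A A-antichain ⟩
    A                                        ∎
    where open ≡-Reasoning

  rowA∘rowA⁻¹ : ∀ A → IsAntichain P A → rowA P (rowA⁻¹ P A) ≡ A
  rowA∘rowA⁻¹ A A-antichain = begin
    ∇ P (Θ P (Δ⁻¹ P (Δ P (Θ P (∇⁻¹ P A)))))  ≡⟨ cong (∇ P ∘ Θ P) (Δ⁻¹∘Δ _ (Θ-filter (∇⁻¹-filter A))) ⟩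
    ∇ P (Θ P (Θ P (∇⁻¹ P A)))                ≡⟨ cong (∇ P) (∁-involutive _) ⟩
    ∇ P (∇⁻¹ P A)                            ≡⟨ ∇∘∇⁻¹ A A-antichain ⟩
    A                                        ∎
    where open ≡-Reasoning

  Δ∘Θ≡rowA⁻¹∘∇ : ∀ F → IsFilter P F → Δ P (Θ P F) ≡ rowA⁻¹ P (∇ P F)
  Δ∘Θ≡rowA⁻¹∘∇ F F-filter = cong (Δ P ∘ Θ P) (sym (∇⁻¹∘∇ F F-filter))

module Graded {n : ℕ} (P : FinitePoset n) (r : ℕ) (rk : Fin n → ℕ) (graded : IsGraded P r rk) where
  open Poset P
  open IsGraded graded

  rank-⋖ : ∀ {x y} → _⋖_ P x y → rk y ≡ suc (rk x)
  rank-⋖ = cover-rank _ _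

  covered-below : ∀ {y x} → y ⊏ x → ∃[ z ] y ≼ z × _⋖_ P z x
  covered-below {y} {x} y⊏x =
    let z , y≼z , (_ , z⊏x) , z-max = maximal-above (λ z → (y ≼? z) ×-dec (z ⊏? x)) (≼-refl , y⊏x)
        z-max′ : ∀ w → z ⊏ w → ¬ w ⊏ x
        z-max′ w z⊏w w⊏x = ⊏-irrefl (subst (z ⊏_) (z-max w (≼-trans y≼z (proj₁ z⊏w) , w⊏x) (proj₁ z⊏w)) z⊏w)
    in z , y≼z , z⊏x , z-max′

  covers-above : ∀ {x y} → x ⊏ y → ∃[ z ] _⋖_ P x z × z ≼ y
  covers-above {x} {y} x⊏y =
    let z , z≼y , (x⊏z , _) , z-min = minimal-below (λ z → (x ⊏? z) ×-dec (z ≼? y)) (x⊏y , ≼-refl)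
        z-min′ : ∀ w → x ⊏ w → ¬ w ⊏ z
        z-min′ w x⊏w w⊏z = ⊏-irrefl (subst (_⊏ z) (z-min w (x⊏w , ≼-trans (proj₁ w⊏z) z≼y) (proj₁ w⊏z)) w⊏z)
    in z , (x⊏z , z-min′) , z≼y

  rank-⊏ : ∀ {y x} → y ⊏ x → rk y < rk x
  rank-⊏ {y} {x} = go (⊏-wellFounded x)
    where
      go : ∀ {x} → Acc _⊏_ x → y ⊏ x → rk y < rk x
      go {x} (acc below) y⊏x =
        let z , y≼z , z⋖x = covered-below y⊏x
            rk-y≤rk-z : rk y ≤ rk z
            rk-y≤rk-z = [ ℕ.≤-reflexive ∘ cong rk , (λ y⊏z → ℕ.<⇒≤ (go (below (proj₁ z⋖x)) y⊏z)) ]′ (≼⇒≡⊎⊏ y≼z)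
        in subst (rk y <_) (sym (rank-⋖ z⋖x)) (s≤s rk-y≤rk-z)

  rank-≼ : ∀ {y x} → y ≼ x → rk y ≤ rk x
  rank-≼ y≼x = [ ℕ.≤-reflexive ∘ cong rk , ℕ.<⇒≤ ∘ rank-⊏ ]′ (≼⇒≡⊎⊏ y≼x)

  rank≤r : ∀ x → rk x ≤ r
  rank≤r x =
    let m , x≼m , _ , m-max = maximal-above {Q = λ _ → ⊤} (λ _ → yes tt) tt
    in subst (rk x ≤_) (maximal-rank m λ y m≼y → m-max y tt m≼y) (rank-≼ x≼m)

module Toggles {n : ℕ} (P : FinitePoset n) where
  open Poset P

  FilterToggled : Subset n → Fin n → Set
  FilterToggled S p = (∃[ y ] y ⊏ p × y ∈ S) ⊎ (p ∉ S × (∀ y → p ⊏ y → y ∈ S))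

  IncomparableTo : Subset n → Fin n → Set
  IncomparableTo A p = ∀ y → y ∈ A → ¬ y ≼ p × ¬ p ≼ y

  removal-filter : ∀ {p S} → IsFilter P S → ¬ (∃[ y ] y ⊏ p × y ∈ S) → IsFilter P (S [ p ]≔ outside)
  removal-filter {p} {S} S-filter nothing-below x y x∈ x≼y with x ≟ p | y ≟ p
  ... | yes refl | _ = ⊥-elim (x∉S[x]≔outside S p x∈)
  ... | no x≢p | yes refl = ⊥-elim (nothing-below (x , (x≼y , x≢p) , to (∈-[]≔-other outside x≢p) x∈))
  ... | no x≢p | no y≢p = from (∈-[]≔-other outside y≢p) (S-filter x y (to (∈-[]≔-other outside x≢p) x∈) x≼y)

  insertion-filter : ∀ {p S} → IsFilter P S → (∀ y → p ⊏ y → y ∈ S) → IsFilter P (S [ p ]≔ inside)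
  insertion-filter {p} {S} S-filter all-above x y x∈ x≼y with y ≟ p | x ≟ p
  ... | yes refl | _ = x∈S[x]≔inside S p
  ... | no y≢p | yes refl = from (∈-[]≔-other inside y≢p) (all-above y (x≼y , λ p≡y → y≢p (sym p≡y)))
  ... | no y≢p | no x≢p = from (∈-[]≔-other inside y≢p) (S-filter x y (to (∈-[]≔-other inside x≢p) x∈) x≼y)

  insertion-antichain : ∀ {p A} → IsAntichain P A → IncomparableTo A p → IsAntichain P (A [ p ]≔ inside)
  insertion-antichain {p} {A} A-antichain incomparable x y x∈ y∈ x≼y with x ≟ p | y ≟ p
  ... | yes refl | yes refl = refl
  ... | yes refl | no y≢p = ⊥-elim (proj₂ (incomparable y (to (∈-[]≔-other inside y≢p) y∈)) x≼y)
  ... | no x≢p | yes refl = ⊥-elim (proj₁ (incomparable x (to (∈-[]≔-other inside x≢p) x∈)) x≼y)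
  ... | no x≢p | no y≢p =
    A-antichain x y (to (∈-[]≔-other inside x≢p) x∈) (to (∈-[]≔-other inside y≢p) y∈) x≼y

  ∈-t-self : ∀ {p S} → IsFilter P S → p ∈ t P p S ⇔ FilterToggled S p
  ∈-t-self {p} {S} S-filter with p ∈? S
  ... | yes p∈S = if-does (λ S′ → p ∈ S′ ⇔ FilterToggled S p) (isFilter? P (S [ p ]≔ outside)) removed kept
    where
      removed : IsFilter P (S [ p ]≔ outside) → p ∈ S [ p ]≔ outside ⇔ FilterToggled S p
      removed removable = mk⇔ (⊥-elim ∘ x∉S[x]≔outside S p) λ
        { (inj₁ (y , y⊏p , y∈S)) → ⊥-elim (x∉S[x]≔outside S p
            (removable y p (from (∈-[]≔-other outside (proj₂ y⊏p)) y∈S) (proj₁ y⊏p)))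
        ; (inj₂ (p∉S , _)) → ⊥-elim (p∉S p∈S) }
      kept : ¬ IsFilter P (S [ p ]≔ outside) → p ∈ S ⇔ FilterToggled S p
      kept unremovable = mk⇔ (λ _ → inj₁ element-below) (λ _ → p∈S)
        where
          element-below : ∃[ y ] y ⊏ p × y ∈ S
          element-below with any? (λ y → (y ⊏? p) ×-dec (y ∈? S))
          ... | yes below = below
          ... | no nothing-below = ⊥-elim (unremovable (removal-filter S-filter nothing-below))
  ... | no p∉S = if-does (λ S′ → p ∈ S′ ⇔ FilterToggled S p) (isFilter? P (S [ p ]≔ inside)) added kept
    where
      added : IsFilter P (S [ p ]≔ inside) → p ∈ S [ p ]≔ inside ⇔ FilterToggled S p
      added insertable = mk⇔
        (λ _ → inj₂ (p∉S , λ y p⊏y → to (∈-[]≔-other inside λ y≡p → proj₂ p⊏y (sym y≡p))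
                                         (insertable p y (x∈S[x]≔inside S p) (proj₁ p⊏y))))
        (λ _ → x∈S[x]≔inside S p)
      kept : ¬ IsFilter P (S [ p ]≔ inside) → p ∈ S ⇔ FilterToggled S p
      kept uninsertable = mk⇔ (⊥-elim ∘ p∉S) λ
        { (inj₁ (y , y⊏p , y∈S)) → ⊥-elim (p∉S (S-filter y p y∈S (proj₁ y⊏p)))
        ; (inj₂ (_ , all-above)) → ⊥-elim (uninsertable (insertion-filter S-filter all-above)) }

  ∈-t-other : ∀ {p S x} → x ≢ p → x ∈ t P p S ⇔ x ∈ S
  ∈-t-other {p} {S} {x} x≢p with p ∈? S
  ... | yes _ = if-does (λ S′ → x ∈ S′ ⇔ x ∈ S) (isFilter? P (S [ p ]≔ outside))
                        (λ _ → ∈-[]≔-other outside x≢p) (λ _ → ⇔.refl)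
  ... | no _ = if-does (λ S′ → x ∈ S′ ⇔ x ∈ S) (isFilter? P (S [ p ]≔ inside))
                       (λ _ → ∈-[]≔-other inside x≢p) (λ _ → ⇔.refl)

  ∈-τ-self : ∀ {p A} → IsAntichain P A → p ∈ τ P p A ⇔ IncomparableTo A p
  ∈-τ-self {p} {A} A-antichain with p ∈? A
  ... | yes p∈A = mk⇔ (⊥-elim ∘ x∉S[x]≔outside A p) λ incomparable → ⊥-elim (proj₁ (incomparable p p∈A) ≼-refl)
  ... | no p∉A = if-does (λ A′ → p ∈ A′ ⇔ IncomparableTo A p) (isAntichain? P (A [ p ]≔ inside))
        added (λ uninsertable → mk⇔ (⊥-elim ∘ p∉A) (⊥-elim ∘ uninsertable ∘ insertion-antichain A-antichain))
    where
      p∈A′ = x∈S[x]≔inside A p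
      added : IsAntichain P (A [ p ]≔ inside) → p ∈ A [ p ]≔ inside ⇔ IncomparableTo A p
      added insertable = mk⇔ (λ _ → incomparable) (λ _ → p∈A′)
        where
          incomparable : IncomparableTo A p
          incomparable y y∈A = (λ y≼p → p∉A (subst (_∈ A) (insertable y p y∈A′ p∈A′ y≼p) y∈A))
                             , (λ p≼y → p∉A (subst (_∈ A) (sym (insertable p y p∈A′ y∈A′ p≼y)) y∈A))
            where y∈A′ = from (∈-[]≔-other inside λ { refl → p∉A y∈A }) y∈A

  ∈-τ-other : ∀ {p A x} → x ≢ p → x ∈ τ P p A ⇔ x ∈ A
  ∈-τ-other {p} {A} {x} x≢p with p ∈? A
  ... | yes _ = ∈-[]≔-other outside x≢p
  ... | no _ = if-does (λ A′ → x ∈ A′ ⇔ x ∈ A) (isAntichain? P (A [ p ]≔ inside))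
                       (λ _ → ∈-[]≔-other inside x≢p) (λ _ → ⇔.refl)

  t-filter : ∀ {p S} → IsFilter P S → IsFilter P (t P p S)
  t-filter {p} {S} S-filter with p ∈? S
  ... | yes _ = if-does (IsFilter P) (isFilter? P (S [ p ]≔ outside)) (λ removable → removable) (λ _ → S-filter)
  ... | no _ = if-does (IsFilter P) (isFilter? P (S [ p ]≔ inside)) (λ insertable → insertable) (λ _ → S-filter)

  τ-antichain : ∀ {p A} → IsAntichain P A → IsAntichain P (τ P p A)
  τ-antichain {p} {A} A-antichain with p ∈? A
  ... | yes _ = λ x y x∈ y∈ → A-antichain x y (shrink x∈) (shrink y∈)
    where
      shrink : ∀ {x} → x ∈ A [ p ]≔ outside → x ∈ A
      shrink {x} x∈ with x ≟ p
      ... | yes refl = ⊥-elim (x∉S[x]≔outside A p x∈)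
      ... | no x≢p = to (∈-[]≔-other outside x≢p) x∈
  ... | no _ = if-does (IsAntichain P) (isAntichain? P (A [ p ]≔ inside))
                       (λ insertable → insertable) (λ _ → A-antichain)

module RankToggles {n : ℕ} (P : FinitePoset n) (rk : Fin n → ℕ)
  (toggle : Fin n → Subset n → Subset n)
  (Valid : Subset n → Set)
  (Toggled : Subset n → Fin n → Set)
  (toggle-valid : ∀ {p S} → Valid S → Valid (toggle p S))
  (∈-toggle-self : ∀ {p S} → Valid S → p ∈ toggle p S ⇔ Toggled S p)
  (∈-toggle-other : ∀ {p S x} → x ≢ p → x ∈ toggle p S ⇔ x ∈ S)
  -- the outcome at p ignores the other elements of its rank, so the toggles of one rank commute
  (Toggled-local : ∀ {S S′ p} → (∀ y → y ≡ p ⊎ rk y ≢ rk p → y ∈ S ⇔ y ∈ S′) →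
                   Toggled S p → Toggled S′ p)
  where

  toggleAll : List (Fin n) → Subset n → Subset n
  toggleAll ps = compose (map toggle ps)

  record ToggledAll (ps : List (Fin n)) (S S′ : Subset n) : Set where
    field
      valid : Valid S′
      ∈-toggled : ∀ {x} → x ∈ₗ ps → x ∈ S′ ⇔ Toggled S x
      ∈-untouched : ∀ {x} → x ∉ₗ ps → x ∈ S′ ⇔ x ∈ S

  toggleAll-spec : ∀ {i ps S} → Unique ps → All (λ p → rk p ≡ i) ps → Valid S →
                   ToggledAll ps S (toggleAll ps S)
  toggleAll-spec AllPairs.[] [] S-valid = record
    { valid = S-valid ; ∈-toggled = λ () ; ∈-untouched = λ _ → ⇔.refl }
  toggleAll-spec {i} {p ∷ ps} {S} (p∉ps AllPairs.∷ ps-unique) (rk-p ∷ ps-rank) S-valid = record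
    { valid = toggle-valid IH.valid
    ; ∈-toggled = λ { (here refl) → ⇔.trans (∈-toggle-self IH.valid) Toggled-S′⇔Toggled-S
                    ; (there x∈ps) → ⇔.trans (∈-toggle-other (≢p x∈ps)) (IH.∈-toggled x∈ps) }
    ; ∈-untouched = λ x∉ → ⇔.trans (∈-toggle-other (x∉ ∘ here)) (IH.∈-untouched (x∉ ∘ there))
    }
    where
      module IH = ToggledAll (toggleAll-spec ps-unique ps-rank S-valid)
      ≢p : ∀ {x} → x ∈ₗ ps → x ≢ p
      ≢p x∈ps x≡p = All.lookup p∉ps x∈ps (sym x≡p)
      agree : ∀ y → y ≡ p ⊎ rk y ≢ rk p → y ∈ toggleAll ps S ⇔ y ∈ S
      agree y y≈p = IH.∈-untouched λ y∈ps →
        [ ≢p y∈ps , (λ rk-y≢rk-p → rk-y≢rk-p (trans (All.lookup ps-rank y∈ps) (sym rk-p))) ]′ y≈p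
      Toggled-S′⇔Toggled-S : Toggled (toggleAll ps S) p ⇔ Toggled S p
      Toggled-S′⇔Toggled-S = mk⇔ (Toggled-local agree) (Toggled-local (λ y y≈p → ⇔.sym (agree y y≈p)))

  rankList-unique : ∀ i → Unique (rankList P rk i)
  rankList-unique i = Unique.filter⁺ (λ p → rk p ≟ℕ i) (Unique.allFin⁺ n)

  rankList-rank : ∀ i → All (λ p → rk p ≡ i) (rankList P rk i)
  rankList-rank i = All.tabulate λ p∈ → proj₂ (∈-filter⁻ (λ p → rk p ≟ℕ i) {xs = allFin n} p∈)

  rankToggle-spec : ∀ i {S} → Valid S → ToggledAll (rankList P rk i) S (toggleAll (rankList P rk i) S)
  rankToggle-spec i = toggleAll-spec (rankList-unique i) (rankList-rank i)

  rankToggle-valid : ∀ i {S} → Valid S → Valid (toggleAll (rankList P rk i) S)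
  rankToggle-valid i = ToggledAll.valid ∘ rankToggle-spec i

  ∈-rankToggle-rank : ∀ i {S x} → Valid S → rk x ≡ i → x ∈ toggleAll (rankList P rk i) S ⇔ Toggled S x
  ∈-rankToggle-rank i S-valid rk-x = ToggledAll.∈-toggled (rankToggle-spec i S-valid)
    (∈-filter⁺ (λ p → rk p ≟ℕ i) (∈-allFin _) rk-x)

  ∈-rankToggle-other : ∀ i {S x} → Valid S → rk x ≢ i → x ∈ toggleAll (rankList P rk i) S ⇔ x ∈ S
  ∈-rankToggle-other i S-valid rk-x≢i = ToggledAll.∈-untouched (rankToggle-spec i S-valid)
    (rk-x≢i ∘ All.lookup (rankList-rank i))

Far : ℕ → ℕ → Set
Far i k = suc i < k ⊎ suc k < i

Far-sym : ∀ {i k} → Far i k → Far k i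
Far-sym = [ inj₂ , inj₁ ]′

Far⇒≢ : ∀ {i k j} → Far i k → j ≤ suc i → i ≤ suc j → j ≢ k
Far⇒≢ (inj₁ 1+i<k) j≤1+i _ = ℕ.<⇒≢ (ℕ.≤-<-trans j≤1+i 1+i<k)
Far⇒≢ (inj₂ 1+k<i) _ i≤1+j = ℕ.>⇒≢ (ℕ.≤-pred (ℕ.<-≤-trans 1+k<i i≤1+j))

module GradedToggles {n : ℕ} (P : FinitePoset n) (r : ℕ) (rk : Fin n → ℕ) (graded : IsGraded P r rk) where
  open Poset P
  open Graded P r rk graded
  open Toggles P public

  FilterToggled-local : ∀ {S S′ p} → (∀ y → y ≡ p ⊎ rk y ≢ rk p → y ∈ S ⇔ y ∈ S′) →
                        FilterToggled S p → FilterToggled S′ p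
  FilterToggled-local agree (inj₁ (y , y⊏p , y∈S)) =
    inj₁ (y , y⊏p , to (agree y (inj₂ (ℕ.<⇒≢ (rank-⊏ y⊏p)))) y∈S)
  FilterToggled-local agree (inj₂ (p∉S , above)) =
    inj₂ (p∉S ∘ from (agree _ (inj₁ refl)) , λ y p⊏y → to (agree y (inj₂ (ℕ.>⇒≢ (rank-⊏ p⊏y)))) (above y p⊏y))

  IncomparableTo-local : ∀ {A A′ p} → (∀ y → y ≡ p ⊎ rk y ≢ rk p → y ∈ A ⇔ y ∈ A′) →
                         IncomparableTo A p → IncomparableTo A′ p
  IncomparableTo-local {A} {A′} {p} agree incomparable y y∈A′ =
      (λ y≼p → proj₁ (incomparable y (back (below y≼p))) y≼p)
    , (λ p≼y → proj₂ (incomparable y (back (above p≼y))) p≼y)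
    where
      back : y ≡ p ⊎ rk y ≢ rk p → y ∈ A
      back y≈p = from (agree y y≈p) y∈A′
      below : y ≼ p → y ≡ p ⊎ rk y ≢ rk p
      below y≼p = [ inj₁ , inj₂ ∘ ℕ.<⇒≢ ∘ rank-⊏ ]′ (≼⇒≡⊎⊏ y≼p)
      above : p ≼ y → y ≡ p ⊎ rk y ≢ rk p
      above p≼y = [ inj₁ ∘ sym , inj₂ ∘ ℕ.>⇒≢ ∘ rank-⊏ ]′ (≼⇒≡⊎⊏ p≼y)

  open RankToggles P rk (t P) (IsFilter P) FilterToggled (λ {p} → t-filter {p}) (λ {p} → ∈-t-self {p})
    (λ {p} → ∈-t-other {p}) FilterToggled-local
    public using ()
    renaming (rankToggle-valid to 𝐭-filter; ∈-rankToggle-rank to ∈-𝐭-rank; ∈-rankToggle-other to ∈-𝐭-other)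
  open RankToggles P rk (τ P) (IsAntichain P) IncomparableTo (λ {p} → τ-antichain {p}) (λ {p} → ∈-τ-self {p})
    (λ {p} → ∈-τ-other {p}) IncomparableTo-local
    public using ()
    renaming (rankToggle-valid to 𝛕-antichain; ∈-rankToggle-rank to ∈-𝛕-rank; ∈-rankToggle-other to ∈-𝛕-other)

  FilterToggledByCovers : Subset n → Fin n → Set
  FilterToggledByCovers S p = (∃[ y ] _⋖_ P y p × y ∈ S) ⊎ (p ∉ S × (∀ y → _⋖_ P p y → y ∈ S))

  FilterToggled⇔ByCovers : ∀ {S p} → IsFilter P S → FilterToggled S p ⇔ FilterToggledByCovers S p
  FilterToggled⇔ByCovers {S} {p} S-filter = mk⇔
    (λ { (inj₁ (y , y⊏p , y∈S)) → let z , y≼z , z⋖p = covered-below y⊏p in inj₁ (z , z⋖p , S-filter y z y∈S y≼z)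
       ; (inj₂ (p∉S , above)) → inj₂ (p∉S , λ y p⋖y → above y (proj₁ p⋖y)) })
    (λ { (inj₁ (y , y⋖p , y∈S)) → inj₁ (y , proj₁ y⋖p , y∈S)
       ; (inj₂ (p∉S , covers)) → inj₂ (p∉S , λ y p⊏y →
           let z , p⋖z , z≼y = covers-above p⊏y in S-filter z y (covers z p⋖z) z≼y) })

  FilterToggled-far : ∀ {S S′ p k} → IsFilter P S → IsFilter P S′ → Far (rk p) k →
                      (∀ y → rk y ≢ k → y ∈ S ⇔ y ∈ S′) → FilterToggled S p ⇔ FilterToggled S′ p
  FilterToggled-far {S} {S′} {p} S-filter S′-filter far agree =
    ⇔.trans (FilterToggled⇔ByCovers S-filter) (⇔.trans by-covers (⇔.sym (FilterToggled⇔ByCovers S′-filter)))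
    where
      agree-below : ∀ {y} → _⋖_ P y p → y ∈ S ⇔ y ∈ S′
      agree-below y⋖p = agree _ (Far⇒≢ far (ℕ.m≤n⇒m≤1+n (ℕ.<⇒≤ (rank-⊏ (proj₁ y⋖p)))) (ℕ.≤-reflexive (rank-⋖ y⋖p)))
      agree-above : ∀ {y} → _⋖_ P p y → y ∈ S ⇔ y ∈ S′
      agree-above p⋖y = agree _ (Far⇒≢ far (ℕ.≤-reflexive (rank-⋖ p⋖y)) (ℕ.m≤n⇒m≤1+n (ℕ.<⇒≤ (rank-⊏ (proj₁ p⋖y)))))
      agree-self : p ∈ S ⇔ p ∈ S′
      agree-self = agree p (Far⇒≢ far (ℕ.n≤1+n _) (ℕ.n≤1+n _))
      by-covers : FilterToggledByCovers S p ⇔ FilterToggledByCovers S′ p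
      by-covers = mk⇔
        (λ { (inj₁ (y , y⋖p , y∈S)) → inj₁ (y , y⋖p , to (agree-below y⋖p) y∈S)
           ; (inj₂ (p∉S , covers)) → inj₂ (p∉S ∘ from agree-self , λ y p⋖y → to (agree-above p⋖y) (covers y p⋖y)) })
        (λ { (inj₁ (y , y⋖p , y∈S′)) → inj₁ (y , y⋖p , from (agree-below y⋖p) y∈S′)
           ; (inj₂ (p∉S′ , covers)) → inj₂ (p∉S′ ∘ to agree-self , λ y p⋖y → from (agree-above p⋖y) (covers y p⋖y)) })

  FilterToggled-twice : ∀ {S S′ p} → IsFilter P S →
                        (∀ y → rk y ≢ rk p → y ∈ S′ ⇔ y ∈ S) → (p ∈ S′ ⇔ FilterToggled S p) →
                        FilterToggled S′ p ⇔ p ∈ S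
  FilterToggled-twice {S} {S′} {p} S-filter agree p∈S′⇔ = mk⇔ toggled⇒ ⇒toggled
    where
      agree-below : ∀ {y} → y ⊏ p → y ∈ S′ ⇔ y ∈ S
      agree-below y⊏p = agree _ (ℕ.<⇒≢ (rank-⊏ y⊏p))
      agree-above : ∀ {y} → p ⊏ y → y ∈ S′ ⇔ y ∈ S
      agree-above p⊏y = agree _ (ℕ.>⇒≢ (rank-⊏ p⊏y))
      toggled⇒ : FilterToggled S′ p → p ∈ S
      toggled⇒ (inj₁ (y , y⊏p , y∈S′)) = S-filter y p (to (agree-below y⊏p) y∈S′) (proj₁ y⊏p)
      toggled⇒ (inj₂ (p∉S′ , above)) with p ∈? S
      ... | yes p∈S = p∈S
      ... | no p∉S = ⊥-elim (p∉S′ (from p∈S′⇔ (inj₂ (p∉S , λ y p⊏y → to (agree-above p⊏y) (above y p⊏y)))))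
      ⇒toggled : p ∈ S → FilterToggled S′ p
      ⇒toggled p∈S with any? (λ y → (y ⊏? p) ×-dec (y ∈? S))
      ... | yes (y , y⊏p , y∈S) = inj₁ (y , y⊏p , from (agree-below y⊏p) y∈S)
      ... | no nothing-below = inj₂ (p∉S′ , λ y p⊏y → from (agree-above p⊏y) (S-filter p y p∈S (proj₁ p⊏y)))
        where
          p∉S′ : p ∉ S′
          p∉S′ p∈S′ = [ nothing-below , (λ (p∉S , _) → p∉S p∈S) ]′ (to p∈S′⇔ p∈S′)

  𝐭-involutive : ∀ i {S} → IsFilter P S → 𝐭 P rk i (𝐭 P rk i S) ≡ S
  𝐭-involutive i {S} S-filter = Subset-≡ λ x → at x (rk x ≟ℕ i)
    where
      S′-filter = 𝐭-filter i S-filter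
      at : ∀ x → Dec (rk x ≡ i) → x ∈ 𝐭 P rk i (𝐭 P rk i S) ⇔ x ∈ S
      at x (yes refl) = ⇔.trans (∈-𝐭-rank i S′-filter refl)
        (FilterToggled-twice S-filter (λ y → ∈-𝐭-other i S-filter) (∈-𝐭-rank i S-filter refl))
      at x (no rk-x≢i) = ⇔.trans (∈-𝐭-other i S′-filter rk-x≢i) (∈-𝐭-other i S-filter rk-x≢i)

  𝐭-commute-at-rank : ∀ {i j S x} → IsFilter P S → Far i j → rk x ≡ i →
                      x ∈ 𝐭 P rk i (𝐭 P rk j S) ⇔ x ∈ 𝐭 P rk j (𝐭 P rk i S)
  𝐭-commute-at-rank {i} {j} {S} {x} S-filter far refl = begin
    x ∈ 𝐭 P rk i (𝐭 P rk j S)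
      ≈⟨ ∈-𝐭-rank i (𝐭-filter j S-filter) refl ⟩
    FilterToggled (𝐭 P rk j S) x
      ≈⟨ FilterToggled-far (𝐭-filter j S-filter) S-filter far (λ y → ∈-𝐭-other j S-filter) ⟩
    FilterToggled S x
      ≈⟨ ∈-𝐭-rank i S-filter refl ⟨
    x ∈ 𝐭 P rk i S
      ≈⟨ ∈-𝐭-other j (𝐭-filter i S-filter) (Far⇒≢ far (ℕ.n≤1+n _) (ℕ.n≤1+n _)) ⟨
    x ∈ 𝐭 P rk j (𝐭 P rk i S) ∎
    where open ⇔-Reasoning

  𝐭-commute : ∀ {i j S} → IsFilter P S → Far i j → 𝐭 P rk i (𝐭 P rk j S) ≡ 𝐭 P rk j (𝐭 P rk i S)
  𝐭-commute {i} {j} {S} S-filter far = Subset-≡ λ x → at x (rk x ≟ℕ i) (rk x ≟ℕ j)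
    where
      at : ∀ x → Dec (rk x ≡ i) → Dec (rk x ≡ j) → x ∈ 𝐭 P rk i (𝐭 P rk j S) ⇔ x ∈ 𝐭 P rk j (𝐭 P rk i S)
      at x (yes rk-x≡i) _ = 𝐭-commute-at-rank S-filter far rk-x≡i
      at x (no _) (yes rk-x≡j) = ⇔.sym (𝐭-commute-at-rank S-filter (Far-sym far) rk-x≡j)
      at x (no rk-x≢i) (no rk-x≢j) = begin
        x ∈ 𝐭 P rk i (𝐭 P rk j S)  ≈⟨ ∈-𝐭-other i (𝐭-filter j S-filter) rk-x≢i ⟩
        x ∈ 𝐭 P rk j S             ≈⟨ ∈-𝐭-other j S-filter rk-x≢j ⟩
        x ∈ S                      ≈⟨ ∈-𝐭-other i S-filter rk-x≢i ⟨
        x ∈ 𝐭 P rk i S             ≈⟨ ∈-𝐭-other j (𝐭-filter i S-filter) rk-x≢j ⟨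
        x ∈ 𝐭 P rk j (𝐭 P rk i S)  ∎
        where open ⇔-Reasoning

downward-induction : ∀ r (Q : ℕ → Set) → (∀ a → r < a → Q a) → (∀ a → a ≤ r → Q (suc a) → Q a) → ∀ a → Q a
downward-induction r Q base step a = go (suc r ∸ a) a refl
  where
    go : ∀ m a → suc r ∸ a ≡ m → Q a
    go zero a r+1∸a≡0 = base a (ℕ.m∸n≡0⇒m≤n r+1∸a≡0)
    go (suc m) a r+1∸a≡1+m with a ≤? r
    ... | yes a≤r = step a a≤r (go m (suc a) (ℕ.suc-injective (trans (sym (ℕ.+-∸-assoc 1 a≤r)) r+1∸a≡1+m)))
    ... | no a≰r = base a (ℕ.≰⇒> a≰r)

⋯-cons : ∀ {a b} → a ≤ b → [ a ⋯ b ] ≡ a ∷ [ suc a ⋯ b ]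
⋯-cons {a} {b} a≤b = begin
  map (a +_) (upTo (suc b ∸ a))              ≡⟨ cong (map (a +_) ∘ upTo) (ℕ.+-∸-assoc 1 a≤b) ⟩
  map (a +_) (upTo (suc (b ∸ a)))            ≡⟨ ListP.map-upTo (a +_) (suc (b ∸ a)) ⟩
  a + 0 ∷ applyUpTo ((a +_) ∘ suc) (b ∸ a)   ≡⟨ cong₂ _∷_ (ℕ.+-identityʳ a) (sym (ListP.map-upTo _ (b ∸ a))) ⟩
  a ∷ map ((a +_) ∘ suc) (upTo (b ∸ a))      ≡⟨ cong (a ∷_) (ListP.map-cong (ℕ.+-suc a) (upTo (b ∸ a))) ⟩
  a ∷ map (suc a +_) (upTo (b ∸ a))          ∎
  where open ≡-Reasoning

⋯-empty : ∀ {a b} → b < a → [ a ⋯ b ] ≡ []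
⋯-empty {a} b<a = cong (map (a +_) ∘ upTo) (ℕ.m≤n⇒m∸n≡0 b<a)

⋯↓-snoc : ∀ {a b} → a ≤ b → [ b ⋯↓ a ] ≡ [ b ⋯↓ suc a ] ∷ʳ a
⋯↓-snoc {a} {b} a≤b = trans (cong reverse (⋯-cons a≤b)) (ListP.unfold-reverse a [ suc a ⋯ b ])

0⋯-snoc : ∀ k → [ 0 ⋯ suc k ] ≡ [ 0 ⋯ k ] ∷ʳ suc k
0⋯-snoc k = trans (cong (map (0 +_)) (sym (ListP.upTo-∷ʳ (suc k)))) (ListP.map-++ (0 +_) (upTo (suc k)) [ suc k ])

0⋯↓-cons : ∀ k → [ suc k ⋯↓ 0 ] ≡ suc k ∷ [ k ⋯↓ 0 ]
0⋯↓-cons k = trans (cong reverse (0⋯-snoc k)) (ListP.reverse-++ [ 0 ⋯ k ] [ suc k ])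

∈-⋯ : ∀ {i} a b → i ∈ₗ [ a ⋯ b ] → a ≤ i × i ≤ b
∈-⋯ {i} a b i∈ with ∈-map⁻ (a +_) i∈ | a ≤? suc b
... | j , j∈ , refl | yes a≤1+b =
  ℕ.m≤m+n a j , ℕ.≤-pred (subst (suc (a + j) ≤_) (ℕ.m+[n∸m]≡n a≤1+b) (ℕ.+-monoʳ-< a (∈-upTo⁻ j∈)))
... | j , j∈ , refl | no a≰1+b with () ← subst (j <_) (ℕ.m≤n⇒m∸n≡0 (ℕ.<⇒≤ (ℕ.≰⇒> a≰1+b))) (∈-upTo⁻ j∈)

∈-⋯↓ : ∀ {i} a b → i ∈ₗ [ b ⋯↓ a ] → a ≤ i × i ≤ b
∈-⋯↓ a b = ∈-⋯ a b ∘ reverse⁻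

compose-++ : {X : Set} (fs gs : List (X → X)) (x : X) → compose (fs ++ gs) x ≡ compose fs (compose gs x)
compose-++ [] gs x = refl
compose-++ (f ∷ fs) gs x = cong f (compose-++ fs gs x)

module Words {X : Set} (T : ℕ → X → X) where
  word : List ℕ → X → X
  word is = compose (map T is)

  word-∷ʳ : ∀ is i x → word (is ∷ʳ i) x ≡ word is (T i x)
  word-∷ʳ is i x = trans (cong (λ fs → compose fs x) (ListP.map-++ T is [ i ])) (compose-++ (map T is) [ T i ] x)

  words : (ℕ → List ℕ) → List ℕ → X → X
  words w ks = compose (map (λ k → word (w k)) ks)

  words-∷ʳ : ∀ w ks k x → words w (ks ∷ʳ k) x ≡ words w ks (word (w k) x)
  words-∷ʳ w ks k x = trans (cong (λ fs → compose fs x) (ListP.map-++ (λ k → word (w k)) ks [ k ]))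
                            (compose-++ (map (λ k → word (w k)) ks) [ word (w k) ] x)

  module Range (r : ℕ) where
    ascending descending : ℕ → X → X
    ascending a = word [ a ⋯ r ]
    descending a = word [ r ⋯↓ a ]

    ascending-step : ∀ {a} x → a ≤ r → ascending a x ≡ T a (ascending (suc a) x)
    ascending-step x a≤r = cong (λ is → word is x) (⋯-cons a≤r)

    descending-step : ∀ {a} x → a ≤ r → descending a x ≡ descending (suc a) (T a x)
    descending-step {a} x a≤r = trans (cong (λ is → word is x) (⋯↓-snoc a≤r)) (word-∷ʳ [ r ⋯↓ suc a ] a x)

    ascending-empty : ∀ {a} x → r < a → ascending a x ≡ x
    ascending-empty x r<a = cong (λ is → word is x) (⋯-empty r<a)

    descending-empty : ∀ {a} x → r < a → descending a x ≡ x
    descending-empty x r<a = cong (λ is → word (reverse is) x) (⋯-empty r<a)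

module InvolutionWords {X : Set} (Good : X → Set) (T : ℕ → X → X)
  (T-good : ∀ i {x} → Good x → Good (T i x))
  (T-involutive : ∀ i {x} → Good x → T i (T i x) ≡ x)
  (T-commute : ∀ {i j x} → Good x → Far i j → T i (T j x) ≡ T j (T i x))
  where
  open Words T public

  word-good : ∀ is {x} → Good x → Good (word is x)
  word-good [] x-good = x-good
  word-good (i ∷ is) x-good = T-good i (word-good is x-good)

  word-reverse-cancel : ∀ is {x} → Good x → word (reverse is) (word is x) ≡ x
  word-reverse-cancel [] x-good = refl
  word-reverse-cancel (i ∷ is) {x} x-good = begin
    word (reverse (i ∷ is)) (T i (word is x))
      ≡⟨ cong (λ js → word js (T i (word is x))) (ListP.unfold-reverse i is) ⟩
    word (reverse is ∷ʳ i) (T i (word is x))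
      ≡⟨ word-∷ʳ (reverse is) i _ ⟩
    word (reverse is) (T i (T i (word is x)))
      ≡⟨ cong (word (reverse is)) (T-involutive i (word-good is x-good)) ⟩
    word (reverse is) (word is x)
      ≡⟨ word-reverse-cancel is x-good ⟩
    x ∎
    where open ≡-Reasoning

  word-commute : ∀ {i} is {x} → Good x → (∀ {j} → j ∈ₗ is → Far i j) → T i (word is x) ≡ word is (T i x)
  word-commute [] x-good far = refl
  word-commute (j ∷ is) x-good far =
    trans (T-commute (word-good is x-good) (far (here refl))) (cong (T j) (word-commute is x-good (far ∘ there)))

  words-good : ∀ w ks {x} → Good x → Good (words w ks x)
  words-good w [] x-good = x-good
  words-good w (k ∷ ks) x-good = word-good (w k) (words-good w ks x-good)

  words-commute : ∀ {i} w ks {x} → Good x → (∀ {k j} → k ∈ₗ ks → j ∈ₗ w k → Far i j) →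
                  T i (words w ks x) ≡ words w ks (T i x)
  words-commute w [] x-good far = refl
  words-commute w (k ∷ ks) x-good far =
    trans (word-commute (w k) (words-good w ks x-good) (far (here refl)))
          (cong (word (w k)) (words-commute w ks x-good (far ∘ there)))

  module Rvac (r : ℕ) where
    open Range r public

    ascendingRange : ℕ → List ℕ
    ascendingRange k = [ k ⋯ r ]

    rvacFrom : ℕ → X → X
    rvacFrom a = words ascendingRange [ r ⋯↓ a ]

    rvacFrom-step : ∀ a x → rvacFrom a x ≡ rvacFrom (suc a) (ascending a x)
    rvacFrom-step a x with a ≤? r
    ... | yes a≤r = trans (cong (λ ks → words ascendingRange ks x) (⋯↓-snoc a≤r))
                              (words-∷ʳ ascendingRange [ r ⋯↓ suc a ] a x)
    ... | no a≰r rewrite ⋯-empty {b = r} (ℕ.≰⇒> a≰r) | ⋯-empty {suc a} {r} (ℕ.m<n⇒m<1+n (ℕ.≰⇒> a≰r)) = refl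

    rvacFrom-commute : ∀ a {x} → Good x → T a (rvacFrom (suc (suc a)) x) ≡ rvacFrom (suc (suc a)) (T a x)
    rvacFrom-commute a x-good = words-commute ascendingRange [ r ⋯↓ suc (suc a) ] x-good λ {k} k∈ j∈ →
      inj₁ (ℕ.≤-trans (proj₁ (∈-⋯↓ (suc (suc a)) r k∈)) (proj₁ (∈-⋯ k r j∈)))

    rvacFrom-unfold : ∀ a {y} → Good y → rvacFrom a y ≡ descending a (rvacFrom (suc a) y)
    rvacFrom-unfold = downward-induction r Unfolds base step
      where
        Unfolds : ℕ → Set
        Unfolds a = ∀ {y} → Good y → rvacFrom a y ≡ descending a (rvacFrom (suc a) y)
        base : ∀ a → r < a → Unfolds a
        base a r<a _ rewrite ⋯-empty r<a | ⋯-empty (ℕ.m<n⇒m<1+n r<a) = refl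
        step : ∀ a → a ≤ r → Unfolds (suc a) → Unfolds a
        step a a≤r IH {y} y-good = begin
          rvacFrom a y
            ≡⟨ rvacFrom-step a y ⟩
          rvacFrom (suc a) (ascending a y)
            ≡⟨ cong (rvacFrom (suc a)) (ascending-step y a≤r) ⟩
          rvacFrom (suc a) (T a y′)
            ≡⟨ IH (T-good a y′-good) ⟩
          descending (suc a) (rvacFrom (suc (suc a)) (T a y′))
            ≡⟨ cong (descending (suc a)) (rvacFrom-commute a y′-good) ⟨
          descending (suc a) (T a (rvacFrom (suc (suc a)) y′))
            ≡⟨ cong (descending (suc a) ∘ T a) (rvacFrom-step (suc a) y) ⟨
          descending (suc a) (T a (rvacFrom (suc a) y))
            ≡⟨ descending-step _ a≤r ⟨
          descending a (rvacFrom (suc a) y) ∎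
          where
            open ≡-Reasoning
            y′ = ascending (suc a) y
            y′-good = word-good [ suc a ⋯ r ] y-good

    rvacFrom-involutive : ∀ a {x} → Good x → rvacFrom a (rvacFrom a x) ≡ x
    rvacFrom-involutive = downward-induction r Involutive base step
      where
        Involutive : ℕ → Set
        Involutive a = ∀ {x} → Good x → rvacFrom a (rvacFrom a x) ≡ x
        base : ∀ a → r < a → Involutive a
        base a r<a _ rewrite ⋯-empty r<a = refl
        step : ∀ a → a ≤ r → Involutive (suc a) → Involutive a
        step a a≤r IH {x} x-good = begin
          rvacFrom a (rvacFrom a x)
            ≡⟨ rvacFrom-unfold a (words-good ascendingRange [ r ⋯↓ a ] x-good) ⟩
          descending a (rvacFrom (suc a) (rvacFrom a x))
            ≡⟨ cong (descending a ∘ rvacFrom (suc a)) (rvacFrom-step a x) ⟩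
          descending a (rvacFrom (suc a) (rvacFrom (suc a) (ascending a x)))
            ≡⟨ cong (descending a) (IH (word-good [ a ⋯ r ] x-good)) ⟩
          descending a (ascending a x)
            ≡⟨ word-reverse-cancel [ a ⋯ r ] x-good ⟩
          x ∎
          where open ≡-Reasoning

    row row⁻¹ rvac : X → X
    row = ascending 0
    row⁻¹ = descending 0
    rvac = rvacFrom 0

    row∘row⁻¹ : ∀ {x} → Good x → row (row⁻¹ x) ≡ x
    row∘row⁻¹ {x} x-good = trans (cong (λ is → word is (row⁻¹ x)) (sym (ListP.reverse-involutive [ 0 ⋯ r ])))
                                 (word-reverse-cancel (reverse [ 0 ⋯ r ]) x-good)

    row-good : ∀ {x} → Good x → Good (row x)
    row-good = word-good [ 0 ⋯ r ]

    row⁻¹-good : ∀ {x} → Good x → Good (row⁻¹ x)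
    row⁻¹-good = word-good [ r ⋯↓ 0 ]

    rvac-good : ∀ {x} → Good x → Good (rvac x)
    rvac-good = words-good ascendingRange [ r ⋯↓ 0 ]

    rvac-involutive : ∀ {x} → Good x → rvac (rvac x) ≡ x
    rvac-involutive = rvacFrom-involutive 0

    rvac∘row : ∀ {x} → Good x → rvac (row x) ≡ row⁻¹ (rvac x)
    rvac∘row {x} x-good =
      trans (rvacFrom-unfold 0 (row-good x-good)) (cong row⁻¹ (sym (rvacFrom-step 0 x)))

  module Rvac* where
    descendingRange : ℕ → List ℕ
    descendingRange k = [ k ⋯↓ 0 ]

    ascendingTo descendingFrom rvac*To : ℕ → X → X
    ascendingTo k = word [ 0 ⋯ k ]
    descendingFrom k = word [ k ⋯↓ 0 ]
    rvac*To k = words descendingRange [ 0 ⋯ k ]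

    ascendingTo-step : ∀ k x → ascendingTo (suc k) x ≡ ascendingTo k (T (suc k) x)
    ascendingTo-step k x = trans (cong (λ is → word is x) (0⋯-snoc k)) (word-∷ʳ [ 0 ⋯ k ] (suc k) x)

    descendingFrom-step : ∀ k x → descendingFrom (suc k) x ≡ T (suc k) (descendingFrom k x)
    descendingFrom-step k x = cong (λ is → word is x) (0⋯↓-cons k)

    rvac*To-step : ∀ k x → rvac*To (suc k) x ≡ rvac*To k (descendingFrom (suc k) x)
    rvac*To-step k x = trans (cong (λ ks → words descendingRange ks x) (0⋯-snoc k))
                           (words-∷ʳ descendingRange [ 0 ⋯ k ] (suc k) x)

    rvac*To-good : ∀ k {x} → Good x → Good (rvac*To k x)
    rvac*To-good k = words-good descendingRange [ 0 ⋯ k ]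

    rvac*To-commute : ∀ k {x} → Good x → T (suc (suc k)) (rvac*To k x) ≡ rvac*To k (T (suc (suc k)) x)
    rvac*To-commute k x-good = words-commute descendingRange [ 0 ⋯ k ] x-good λ {j} j∈ i∈ →
      inj₂ (s≤s (s≤s (ℕ.≤-trans (proj₂ (∈-⋯↓ 0 j i∈)) (proj₂ (∈-⋯ 0 k j∈)))))

    rvac*To-unfold : ∀ k {y} → Good y → rvac*To (suc k) y ≡ ascendingTo (suc k) (rvac*To k y)
    rvac*To-unfold zero y-good = refl
    rvac*To-unfold (suc k) {y} y-good = begin
      rvac*To (suc (suc k)) y
        ≡⟨ rvac*To-step (suc k) y ⟩
      rvac*To (suc k) (descendingFrom (suc (suc k)) y)
        ≡⟨ cong (rvac*To (suc k)) (descendingFrom-step (suc k) y) ⟩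
      rvac*To (suc k) (T (suc (suc k)) y′)
        ≡⟨ rvac*To-unfold k (T-good _ y′-good) ⟩
      ascendingTo (suc k) (rvac*To k (T (suc (suc k)) y′))
        ≡⟨ cong (ascendingTo (suc k)) (rvac*To-commute k y′-good) ⟨
      ascendingTo (suc k) (T (suc (suc k)) (rvac*To k y′))
        ≡⟨ cong (ascendingTo (suc k) ∘ T (suc (suc k))) (rvac*To-step k y) ⟨
      ascendingTo (suc k) (T (suc (suc k)) (rvac*To (suc k) y))
        ≡⟨ ascendingTo-step (suc k) _ ⟨
      ascendingTo (suc (suc k)) (rvac*To (suc k) y) ∎
      where
        open ≡-Reasoning
        y′ = descendingFrom (suc k) y
        y′-good = word-good [ suc k ⋯↓ 0 ] y-good

    rvac*To-involutive : ∀ k {x} → Good x → rvac*To k (rvac*To k x) ≡ x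
    rvac*To-involutive zero x-good = T-involutive 0 x-good
    rvac*To-involutive (suc k) {x} x-good = begin
      rvac*To (suc k) (rvac*To (suc k) x)
        ≡⟨ rvac*To-step k _ ⟩
      rvac*To k (descendingFrom (suc k) (rvac*To (suc k) x))
        ≡⟨ cong (rvac*To k ∘ descendingFrom (suc k)) (rvac*To-unfold k x-good) ⟩
      rvac*To k (descendingFrom (suc k) (ascendingTo (suc k) (rvac*To k x)))
        ≡⟨ cong (rvac*To k) (word-reverse-cancel [ 0 ⋯ suc k ] (rvac*To-good k x-good)) ⟩
      rvac*To k (rvac*To k x)
        ≡⟨ rvac*To-involutive k x-good ⟩
      x ∎
      where open ≡-Reasoning

    rvac*To∘ascendingTo : ∀ k {x} → Good x → rvac*To k (ascendingTo k x) ≡ descendingFrom k (rvac*To k x)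
    rvac*To∘ascendingTo zero x-good = refl
    rvac*To∘ascendingTo (suc k) {x} x-good = begin
      rvac*To (suc k) (ascendingTo (suc k) x)
        ≡⟨ rvac*To-step k _ ⟩
      rvac*To k (descendingFrom (suc k) (ascendingTo (suc k) x))
        ≡⟨ cong (rvac*To k) (word-reverse-cancel [ 0 ⋯ suc k ] x-good) ⟩
      rvac*To k x
        ≡⟨ word-reverse-cancel [ 0 ⋯ suc k ] (rvac*To-good k x-good) ⟨
      descendingFrom (suc k) (ascendingTo (suc k) (rvac*To k x))
        ≡⟨ cong (descendingFrom (suc k)) (rvac*To-unfold k x-good) ⟨
      descendingFrom (suc k) (rvac*To (suc k) x) ∎
      where open ≡-Reasoning

compose-intertwine : {X Y : Set} (Good : X → Set) (f : X → Y) (g : ℕ → X → X) (h : ℕ → Y → Y) →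
                     (∀ k {x} → Good x → Good (g k x)) → (∀ k {x} → Good x → f (g k x) ≡ h k (f x)) →
                     ∀ ks {x} → Good x → f (compose (map g ks) x) ≡ compose (map h ks) (f x)
compose-intertwine Good f g h g-good f∘g≡h∘f [] x-good = refl
compose-intertwine Good f g h g-good f∘g≡h∘f (k ∷ ks) x-good =
  trans (f∘g≡h∘f k (compose-good ks)) (cong (h k) (compose-intertwine Good f g h g-good f∘g≡h∘f ks x-good))
  where
    compose-good : ∀ ks → Good (compose (map g ks) _)
    compose-good [] = x-good
    compose-good (k ∷ ks) = g-good k (compose-good ks)

module Equivariance {n : ℕ} (P : FinitePoset n) (r : ℕ) (rk : Fin n → ℕ) (graded : IsGraded P r rk) where
  open Poset P
  open Graded P r rk graded
  open GradedToggles P r rk graded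
  open InvolutionWords (IsFilter P) (𝐭 P rk) 𝐭-filter 𝐭-involutive 𝐭-commute public
  module 𝛕-Words = Words (𝛕 P rk)

  ∇-agree-below : ∀ {S S′ k x} → (∀ {y} → rk y < k → y ∈ S ⇔ y ∈ S′) → rk x < k → x ∈ ∇ P S ⇔ x ∈ ∇ P S′
  ∇-agree-below {S} {S′} {k} {x} agree rk-x<k = mk⇔ (transfer agree) (transfer (⇔.sym ∘ agree))
    where
      transfer : ∀ {S S′} → (∀ {y} → rk y < k → y ∈ S ⇔ y ∈ S′) → x ∈ ∇ P S → x ∈ ∇ P S′
      transfer agree x∈ = let x∈S , x-min = to ∈-∇ x∈ in from ∈-∇
        (to (agree rk-x<k) x∈S , λ y y∈S′ y≼x →
          let rk-y<k = ℕ.≤-<-trans (rank-≼ y≼x) rk-x<k in x-min y (from (agree rk-y<k) y∈S′) y≼x)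

  record PartialRow (F : Subset n) (k : ℕ) (G : Subset n) : Set where
    field
      filter : IsFilter P G
      below : ∀ {x} → rk x < k → x ∈ G ⇔ x ∈ F
      from-k : ∀ {x} → k ≤ rk x → x ∈ G ⇔ x ∉ Δ⁻¹ P (∇ P F)

  module _ {F : Subset n} (F-filter : IsFilter P F) where
    FilterToggled-PartialRow : ∀ {k G x} → PartialRow F (suc k) G → rk x ≡ k →
                               FilterToggled G x ⇔ x ∉ Δ⁻¹ P (∇ P F)
    FilterToggled-PartialRow {k} {G} {x} G-row refl = mk⇔ toggled⇒ ⇒toggled
      where
        open PartialRow G-row
        below-x : ∀ {y} → y ≼ x → y ∈ G ⇔ y ∈ F
        below-x y≼x = below (s≤s (rank-≼ y≼x))
        toggled⇒ : FilterToggled G x → x ∉ Δ⁻¹ P (∇ P F)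
        toggled⇒ toggled x∈I with to ∈-Δ⁻¹ x∈I
        toggled⇒ (inj₁ (y , y⊏x , y∈G)) _ | a , a∈A , x≼a =
          let y∈F = to (below-x (proj₁ y⊏x)) y∈G
              y≡a = proj₂ (to ∈-∇ a∈A) y y∈F (≼-trans (proj₁ y⊏x) x≼a)
          in proj₂ y⊏x (antisym (proj₁ y⊏x) (subst (x ≼_) (sym y≡a) x≼a))
        toggled⇒ (inj₂ (x∉G , above)) _ | a , a∈A , x≼a with ≼⇒≡⊎⊏ x≼a
        ... | inj₁ refl = x∉G (from (below-x ≼-refl) (proj₁ (to ∈-∇ a∈A)))
        ... | inj₂ x⊏a = to (from-k (rank-⊏ x⊏a)) (above a x⊏a) (from ∈-Δ⁻¹ (a , a∈A , ≼-refl))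
        ⇒toggled : x ∉ Δ⁻¹ P (∇ P F) → FilterToggled G x
        ⇒toggled x∉I with x ∈? F
        ... | no x∉F = inj₂ (x∉F ∘ to (below-x ≼-refl) , λ y x⊏y →
              from (from-k (rank-⊏ x⊏y)) λ y∈I → x∉I (Δ⁻¹-ideal _ x y y∈I (proj₁ x⊏y)))
        ... | yes x∈F with any? (λ y → (y ⊏? x) ×-dec (y ∈? F))
        ...   | yes (y , y⊏x , y∈F) = inj₁ (y , y⊏x , from (below-x (proj₁ y⊏x)) y∈F)
        ...   | no nothing-below = ⊥-elim (x∉I (from ∈-Δ⁻¹ (x , from ∈-∇ (x∈F , x-min) , ≼-refl)))
          where
            x-min : ∀ y → y ∈ F → y ≼ x → y ≡ x
            x-min y y∈F y≼x = [ (λ y≡x → y≡x) , (λ y⊏x → ⊥-elim (nothing-below (y , y⊏x , y∈F))) ]′ (≼⇒≡⊎⊏ y≼x)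

    PartialRow-𝐭 : ∀ {k G} → PartialRow F (suc k) G → PartialRow F k (𝐭 P rk k G)
    PartialRow-𝐭 {k} {G} G-row = record
      { filter = 𝐭-filter k filter
      ; below = λ rk-x<k → ⇔.trans (∈-𝐭-other k filter (ℕ.<⇒≢ rk-x<k)) (below (ℕ.m<n⇒m<1+n rk-x<k))
      ; from-k = λ {x} k≤rk-x → at-or-above x k≤rk-x (rk x ≟ℕ k)
      }
      where
        open PartialRow G-row
        at-or-above : ∀ x → k ≤ rk x → Dec (rk x ≡ k) → x ∈ 𝐭 P rk k G ⇔ x ∉ Δ⁻¹ P (∇ P F)
        at-or-above x _ (yes rk-x≡k) = ⇔.trans (∈-𝐭-rank k filter rk-x≡k) (FilterToggled-PartialRow G-row rk-x≡k)
        at-or-above x k≤rk-x (no rk-x≢k) =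
          ⇔.trans (∈-𝐭-other k filter rk-x≢k) (from-k (ℕ.≤∧≢⇒< k≤rk-x (rk-x≢k ∘ sym)))

    PartialRow-ascending : ∀ k → PartialRow F k (Rvac.ascending r k F)
    PartialRow-ascending = downward-induction r _ base step
      where
        base : ∀ k → r < k → PartialRow F k (Rvac.ascending r k F)
        base k r<k rewrite Rvac.ascending-empty r F r<k = record
          { filter = F-filter
          ; below = λ _ → ⇔.refl
          ; from-k = λ {x} k≤rk-x → ⊥-elim (ℕ.<-irrefl refl (ℕ.<-≤-trans r<k (ℕ.≤-trans k≤rk-x (rank≤r x))))
          }
        step : ∀ k → k ≤ r → PartialRow F (suc k) (Rvac.ascending r (suc k) F) → PartialRow F k (Rvac.ascending r k F)
        step k k≤r G-row rewrite Rvac.ascending-step r F k≤r = PartialRow-𝐭 G-row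

    row≡rowF : Rvac.row r F ≡ rowF P F
    row≡rowF = Subset-≡ λ x → ⇔.trans (PartialRow.from-k (PartialRow-ascending 0) z≤n) (⇔.sym ∈-∁)

  -- What 𝛕_{j-1} ⋯ 𝛕_k makes of ∇ F, when G = 𝐭_k ⋯ 𝐭_r F; below rank k, ∇ G and ∇ F agree.
  record PartialRowA (F G : Subset n) (j : ℕ) (B : Subset n) : Set where
    field
      antichain : IsAntichain P B
      below-j : ∀ {x} → rk x < j → x ∈ B ⇔ x ∈ ∇ P G
      from-j : ∀ {x} → j ≤ rk x → x ∈ B ⇔ x ∈ ∇ P F

  module _ {F G : Subset n} {k : ℕ} (G-row : PartialRow F k G) where
    open PartialRow G-row

    IncomparableTo-PartialRowA : ∀ {j B x} → k ≤ j → PartialRowA F G j B → rk x ≡ j →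
                                 IncomparableTo B x ⇔ x ∈ ∇ P G
    IncomparableTo-PartialRowA {j} {B} {x} k≤j B-row refl = mk⇔ incomparable⇒ ⇒incomparable
      where
        open PartialRowA B-row
        x∈G⇔ : x ∈ G ⇔ x ∉ Δ⁻¹ P (∇ P F)
        x∈G⇔ = from-k k≤j
        x∈B⇒x∈I : x ∈ B → x ∈ Δ⁻¹ P (∇ P F)
        x∈B⇒x∈I x∈B = from ∈-Δ⁻¹ (x , to (from-j ℕ.≤-refl) x∈B , ≼-refl)
        ⇒incomparable : x ∈ ∇ P G → IncomparableTo B x
        ⇒incomparable x∈∇G y y∈B = below-x , above-x
          where
            x∉I = to x∈G⇔ (proj₁ (to ∈-∇ x∈∇G))
            below-x : ¬ y ≼ x
            below-x y≼x with ≼⇒≡⊎⊏ y≼x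
            ... | inj₁ refl = x∉I (x∈B⇒x∈I y∈B)
            ... | inj₂ y⊏x = proj₂ y⊏x (proj₂ (to ∈-∇ x∈∇G) y (proj₁ (to ∈-∇ (to (below-j (rank-⊏ y⊏x)) y∈B))) y≼x)
            above-x : ¬ x ≼ y
            above-x x≼y with ≼⇒≡⊎⊏ x≼y
            ... | inj₁ refl = x∉I (x∈B⇒x∈I y∈B)
            ... | inj₂ x⊏y = x∉I (from ∈-Δ⁻¹ (y , to (from-j (ℕ.<⇒≤ (rank-⊏ x⊏y))) y∈B , x≼y))
        incomparable⇒ : IncomparableTo B x → x ∈ ∇ P G
        incomparable⇒ incomparable = from ∈-∇ (x∈G , x-min)
          where
            x∈G : x ∈ G
            x∈G = from x∈G⇔ λ x∈I → let a , a∈A , x≼a = to ∈-Δ⁻¹ x∈I in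
              proj₂ (incomparable a (from (from-j (rank-≼ x≼a)) a∈A)) x≼a
            x-min : ∀ y → y ∈ G → y ≼ x → y ≡ x
            x-min y y∈G y≼x with ≼⇒≡⊎⊏ y≼x
            ... | inj₁ y≡x = y≡x
            ... | inj₂ y⊏x =
              let m , m≼y , m-min = minimal-below (_∈? G) y∈G
                  m∈B = from (below-j (ℕ.≤-<-trans (rank-≼ m≼y) (rank-⊏ y⊏x))) (from ∈-∇ m-min)
              in ⊥-elim (proj₁ (incomparable m m∈B) (≼-trans m≼y y≼x))

    PartialRowA-𝛕 : ∀ {j B} → k ≤ j → PartialRowA F G j B → PartialRowA F G (suc j) (𝛕 P rk j B)
    PartialRowA-𝛕 {j} {B} k≤j B-row = record
      { antichain = 𝛕-antichain j antichain
      ; below-j = λ {x} rk-x<1+j → at-or-below x rk-x<1+j (rk x ≟ℕ j)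
      ; from-j = λ 1+j≤rk-x → ⇔.trans (∈-𝛕-other j antichain (ℕ.>⇒≢ 1+j≤rk-x)) (from-j (ℕ.<⇒≤ 1+j≤rk-x))
      }
      where
        open PartialRowA B-row
        at-or-below : ∀ x → rk x < suc j → Dec (rk x ≡ j) → x ∈ 𝛕 P rk j B ⇔ x ∈ ∇ P G
        at-or-below x _ (yes rk-x≡j) =
          ⇔.trans (∈-𝛕-rank j antichain rk-x≡j) (IncomparableTo-PartialRowA k≤j B-row rk-x≡j)
        at-or-below x rk-x<1+j (no rk-x≢j) =
          ⇔.trans (∈-𝛕-other j antichain rk-x≢j) (below-j (ℕ.≤∧≢⇒< (ℕ.≤-pred rk-x<1+j) rk-x≢j))

    ∇-PartialRow : ∇ P G ≡ 𝛕-Words.Range.descending r k (∇ P F)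
    ∇-PartialRow = sym (descending-PartialRowA k ℕ.≤-refl initial)
      where
        initial : PartialRowA F G k (∇ P F)
        initial = record
          { antichain = ∇-antichain F
          ; below-j = λ rk-x<k → ∇-agree-below (⇔.sym ∘ below) rk-x<k
          ; from-j = λ _ → ⇔.refl
          }
        Completes : ℕ → Set
        Completes j = k ≤ j → ∀ {B} → PartialRowA F G j B → 𝛕-Words.Range.descending r j B ≡ ∇ P G
        descending-PartialRowA : ∀ j → Completes j
        descending-PartialRowA = downward-induction r Completes base step
          where
            base : ∀ j → r < j → Completes j
            base j r<j _ {B} B-row = trans (𝛕-Words.Range.descending-empty r B r<j)
              (Subset-≡ λ x → PartialRowA.below-j B-row (ℕ.≤-<-trans (rank≤r x) r<j))
            step : ∀ j → j ≤ r → Completes (suc j) → Completes j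
            step j j≤r IH k≤j {B} B-row = trans (𝛕-Words.Range.descending-step r B j≤r)
              (IH (ℕ.m≤n⇒m≤1+n k≤j) (PartialRowA-𝛕 k≤j B-row))

  ∈-Δ∘Θ : ∀ {S x} → x ∈ Δ P (Θ P S) ⇔ IsMaximalIn (_∉ S) x
  ∈-Δ∘Θ = mk⇔
    (λ x∈ → let x∈∁S , x-max = to ∈-Δ x∈ in to ∈-∁ x∈∁S , λ y y∉S x≼y → x-max y (from ∈-∁ y∉S) x≼y)
    (λ (x∉S , x-max) → from ∈-Δ (from ∈-∁ x∉S , λ y y∈∁S x≼y → x-max y (to ∈-∁ y∈∁S) x≼y))

  Δ∘Θ-agree-above : ∀ {S S′ k x} → (∀ {y} → k ≤ rk y → y ∈ S ⇔ y ∈ S′) → k ≤ rk x →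
                    x ∈ Δ P (Θ P S) ⇔ x ∈ Δ P (Θ P S′)
  Δ∘Θ-agree-above {S} {S′} {k} {x} agree k≤rk-x = mk⇔ (transfer agree) (transfer (⇔.sym ∘ agree))
    where
      transfer : ∀ {S S′} → (∀ {y} → k ≤ rk y → y ∈ S ⇔ y ∈ S′) → x ∈ Δ P (Θ P S) → x ∈ Δ P (Θ P S′)
      transfer agree x∈ = let x∉S , x-max = to ∈-Δ∘Θ x∈ in from ∈-Δ∘Θ
        (x∉S ∘ from (agree k≤rk-x) , λ y y∉S′ x≼y →
          let k≤rk-y = ℕ.≤-trans k≤rk-x (rank-≼ x≼y) in x-max y (y∉S′ ∘ to (agree k≤rk-y)) x≼y)

  record PartialRow⁻¹ (F : Subset n) (k : ℕ) (G : Subset n) : Set where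
    field
      filter : IsFilter P G
      below-k : ∀ {x} → rk x < k → x ∈ G ⇔ x ∈ ∇⁻¹ P (Δ P (Θ P F))
      from-k : ∀ {x} → k ≤ rk x → x ∈ G ⇔ x ∈ F

  module _ {F : Subset n} (F-filter : IsFilter P F) where
    FilterToggled-PartialRow⁻¹ : ∀ {k G x} → PartialRow⁻¹ F k G → rk x ≡ k →
                                 FilterToggled G x ⇔ x ∈ ∇⁻¹ P (Δ P (Θ P F))
    FilterToggled-PartialRow⁻¹ {k} {G} {x} G-row refl = mk⇔ toggled⇒ ⇒toggled
      where
        open PartialRow⁻¹ G-row
        above-x : ∀ {y} → x ≼ y → y ∈ G ⇔ y ∈ F
        above-x x≼y = from-k (rank-≼ x≼y)
        toggled⇒ : FilterToggled G x → x ∈ ∇⁻¹ P (Δ P (Θ P F))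
        toggled⇒ (inj₁ (y , y⊏x , y∈G)) =
          let d , d∈D , d≼y = to ∈-∇⁻¹ (to (below-k (rank-⊏ y⊏x)) y∈G)
          in from ∈-∇⁻¹ (d , d∈D , ≼-trans d≼y (proj₁ y⊏x))
        toggled⇒ (inj₂ (x∉G , above)) = from ∈-∇⁻¹ (x , from ∈-Δ∘Θ (x∉G ∘ from (above-x ≼-refl) , x-max) , ≼-refl)
          where
            x-max : ∀ y → y ∉ F → x ≼ y → y ≡ x
            x-max y y∉F x≼y with ≼⇒≡⊎⊏ x≼y
            ... | inj₁ x≡y = sym x≡y
            ... | inj₂ x⊏y = ⊥-elim (y∉F (to (above-x x≼y) (above y x⊏y)))
        ⇒toggled : x ∈ ∇⁻¹ P (Δ P (Θ P F)) → FilterToggled G x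
        ⇒toggled x∈U with to ∈-∇⁻¹ x∈U
        ... | d , d∈D , d≼x with ≼⇒≡⊎⊏ d≼x
        ...   | inj₂ d⊏x = inj₁ (d , d⊏x , from (below-k (rank-⊏ d⊏x)) (from ∈-∇⁻¹ (d , d∈D , ≼-refl)))
        ...   | inj₁ refl = inj₂ (x∉F ∘ to (above-x ≼-refl) , λ y x⊏y → from (above-x (proj₁ x⊏y)) (y∈F y x⊏y))
          where
            x∉F = proj₁ (to ∈-Δ∘Θ d∈D)
            y∈F : ∀ y → x ⊏ y → y ∈ F
            y∈F y x⊏y with y ∈? F
            ... | yes y∈F = y∈F
            ... | no y∉F = ⊥-elim (proj₂ x⊏y (sym (proj₂ (to ∈-Δ∘Θ d∈D) y y∉F (proj₁ x⊏y))))

    PartialRow⁻¹-𝐭 : ∀ {k G} → PartialRow⁻¹ F k G → PartialRow⁻¹ F (suc k) (𝐭 P rk k G)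
    PartialRow⁻¹-𝐭 {k} {G} G-row = record
      { filter = 𝐭-filter k filter
      ; below-k = λ {x} rk-x<1+k → at-or-below x rk-x<1+k (rk x ≟ℕ k)
      ; from-k = λ 1+k≤rk-x → ⇔.trans (∈-𝐭-other k filter (ℕ.>⇒≢ 1+k≤rk-x)) (from-k (ℕ.<⇒≤ 1+k≤rk-x))
      }
      where
        open PartialRow⁻¹ G-row
        at-or-below : ∀ x → rk x < suc k → Dec (rk x ≡ k) → x ∈ 𝐭 P rk k G ⇔ x ∈ ∇⁻¹ P (Δ P (Θ P F))
        at-or-below x _ (yes rk-x≡k) = ⇔.trans (∈-𝐭-rank k filter rk-x≡k) (FilterToggled-PartialRow⁻¹ G-row rk-x≡k)
        at-or-below x rk-x<1+k (no rk-x≢k) =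
          ⇔.trans (∈-𝐭-other k filter rk-x≢k) (below-k (ℕ.≤∧≢⇒< (ℕ.≤-pred rk-x<1+k) rk-x≢k))

    PartialRow⁻¹-descendingFrom : ∀ k → PartialRow⁻¹ F (suc k) (Rvac*.descendingFrom k F)
    PartialRow⁻¹-descendingFrom zero = PartialRow⁻¹-𝐭 record
      { filter = F-filter ; below-k = λ () ; from-k = λ _ → ⇔.refl }
    PartialRow⁻¹-descendingFrom (suc k) rewrite Rvac*.descendingFrom-step k F =
      PartialRow⁻¹-𝐭 (PartialRow⁻¹-descendingFrom k)

  -- What 𝛕_j ⋯ 𝛕_k makes of Δ (Θ F), when K = 𝐭_k ⋯ 𝐭_0 F; above rank k, Δ (Θ K) and Δ (Θ F) agree.
  record PartialRow⁻¹A (F K : Subset n) (j : ℕ) (B : Subset n) : Set where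
    field
      antichain : IsAntichain P B
      below-j : ∀ {x} → rk x < j → x ∈ B ⇔ x ∈ Δ P (Θ P F)
      from-j : ∀ {x} → j ≤ rk x → x ∈ B ⇔ x ∈ Δ P (Θ P K)

  module _ {F K : Subset n} {k : ℕ} (K-row : PartialRow⁻¹ F (suc k) K) where
    open PartialRow⁻¹ K-row

    IncomparableTo-PartialRow⁻¹A : ∀ {j B x} → j ≤ k → PartialRow⁻¹A F K (suc j) B → rk x ≡ j →
                                   IncomparableTo B x ⇔ x ∈ Δ P (Θ P K)
    IncomparableTo-PartialRow⁻¹A {j} {B} {x} j≤k B-row refl = mk⇔ incomparable⇒ ⇒incomparable
      where
        open PartialRow⁻¹A B-row
        x∈K⇔ : x ∈ K ⇔ x ∈ ∇⁻¹ P (Δ P (Θ P F))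
        x∈K⇔ = below-k (s≤s j≤k)
        below-x∈B⇒x∈U : ∀ {y} → y ∈ B → y ≼ x → x ∈ ∇⁻¹ P (Δ P (Θ P F))
        below-x∈B⇒x∈U y∈B y≼x = from ∈-∇⁻¹ (_ , to (below-j (s≤s (rank-≼ y≼x))) y∈B , y≼x)
        ⇒incomparable : x ∈ Δ P (Θ P K) → IncomparableTo B x
        ⇒incomparable x∈ΔΘK y y∈B = x∉U ∘ below-x∈B⇒x∈U y∈B , above-x
          where
            x∉U = proj₁ (to ∈-Δ∘Θ x∈ΔΘK) ∘ from x∈K⇔
            above-x : ¬ x ≼ y
            above-x x≼y with ≼⇒≡⊎⊏ x≼y
            ... | inj₁ refl = x∉U (below-x∈B⇒x∈U y∈B ≼-refl)
            ... | inj₂ x⊏y = proj₂ x⊏y (sym (proj₂ (to ∈-Δ∘Θ x∈ΔΘK) y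
                               (proj₁ (to ∈-Δ∘Θ (to (from-j (rank-⊏ x⊏y)) y∈B))) x≼y))
        incomparable⇒ : IncomparableTo B x → x ∈ Δ P (Θ P K)
        incomparable⇒ incomparable = from ∈-Δ∘Θ (x∉K , x-max)
          where
            x∉K : x ∉ K
            x∉K x∈K = let d , d∈D , d≼x = to ∈-∇⁻¹ (to x∈K⇔ x∈K) in
              proj₁ (incomparable d (from (below-j (s≤s (rank-≼ d≼x))) d∈D)) d≼x
            x-max : ∀ y → y ∉ K → x ≼ y → y ≡ x
            x-max y y∉K x≼y with ≼⇒≡⊎⊏ x≼y
            ... | inj₁ x≡y = sym x≡y
            ... | inj₂ x⊏y =
              let M , y≼M , M-max = maximal-above (λ z → ¬? (z ∈? K)) y∉K
                  M∈B = from (from-j (ℕ.<-≤-trans (rank-⊏ x⊏y) (rank-≼ y≼M))) (from ∈-Δ∘Θ M-max)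
              in ⊥-elim (proj₂ (incomparable _ M∈B) (≼-trans x≼y y≼M))

    PartialRow⁻¹A-𝛕 : ∀ {j B} → j ≤ k → PartialRow⁻¹A F K (suc j) B → PartialRow⁻¹A F K j (𝛕 P rk j B)
    PartialRow⁻¹A-𝛕 {j} {B} j≤k B-row = record
      { antichain = 𝛕-antichain j antichain
      ; below-j = λ rk-x<j → ⇔.trans (∈-𝛕-other j antichain (ℕ.<⇒≢ rk-x<j)) (below-j (ℕ.m<n⇒m<1+n rk-x<j))
      ; from-j = λ {x} j≤rk-x → at-or-above x j≤rk-x (rk x ≟ℕ j)
      }
      where
        open PartialRow⁻¹A B-row
        at-or-above : ∀ x → j ≤ rk x → Dec (rk x ≡ j) → x ∈ 𝛕 P rk j B ⇔ x ∈ Δ P (Θ P K)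
        at-or-above x _ (yes rk-x≡j) =
          ⇔.trans (∈-𝛕-rank j antichain rk-x≡j) (IncomparableTo-PartialRow⁻¹A j≤k B-row rk-x≡j)
        at-or-above x j≤rk-x (no rk-x≢j) =
          ⇔.trans (∈-𝛕-other j antichain rk-x≢j) (from-j (ℕ.≤∧≢⇒< j≤rk-x (rk-x≢j ∘ sym)))

    Δ∘Θ-PartialRow⁻¹ : Δ P (Θ P K) ≡ 𝛕-Words.Range.ascending k 0 (Δ P (Θ P F))
    Δ∘Θ-PartialRow⁻¹ = Subset-≡ λ x → ⇔.sym (PartialRow⁻¹A.from-j (ascending-PartialRow⁻¹A 0) z≤n)
      where
        ascending-PartialRow⁻¹A : ∀ j → PartialRow⁻¹A F K j (𝛕-Words.Range.ascending k j (Δ P (Θ P F)))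
        ascending-PartialRow⁻¹A = downward-induction k _ base step
          where
            base : ∀ j → k < j → PartialRow⁻¹A F K j (𝛕-Words.Range.ascending k j (Δ P (Θ P F)))
            base j k<j rewrite 𝛕-Words.Range.ascending-empty k (Δ P (Θ P F)) k<j = record
              { antichain = Δ-antichain _
              ; below-j = λ _ → ⇔.refl
              ; from-j = λ j≤rk-x → Δ∘Θ-agree-above (⇔.sym ∘ from-k) (ℕ.≤-trans k<j j≤rk-x)
              }
            step : ∀ j → j ≤ k → PartialRow⁻¹A F K (suc j) (𝛕-Words.Range.ascending k (suc j) (Δ P (Θ P F))) →
                   PartialRow⁻¹A F K j (𝛕-Words.Range.ascending k j (Δ P (Θ P F)))
            step j j≤k B-row rewrite 𝛕-Words.Range.ascending-step k (Δ P (Θ P F)) j≤k = PartialRow⁻¹A-𝛕 j≤k B-row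

  ∇∘rvacF : ∀ {F} → IsFilter P F → ∇ P (rvacF P rk r F) ≡ rvacA P rk r (∇ P F)
  ∇∘rvacF = compose-intertwine (IsFilter P) (∇ P) (Rvac.ascending r) (𝛕-Words.Range.descending r)
    (λ k → word-good [ k ⋯ r ]) (λ k G-filter → ∇-PartialRow (PartialRow-ascending G-filter k)) [ r ⋯↓ 0 ]

  Δ∘Θ∘rvacF* : ∀ {F} → IsFilter P F → Δ P (Θ P (rvacF* P rk r F)) ≡ rvacA* P rk r (Δ P (Θ P F))
  Δ∘Θ∘rvacF* = compose-intertwine (IsFilter P) (Δ P ∘ Θ P) Rvac*.descendingFrom (λ k → 𝛕-Words.Range.ascending k 0)
    (λ k → word-good [ k ⋯↓ 0 ]) (λ k G-filter → Δ∘Θ-PartialRow⁻¹ (PartialRow⁻¹-descendingFrom G-filter k)) [ 0 ⋯ r ]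

  open Rvac r public using (row; row⁻¹; row-good; row⁻¹-good; row∘row⁻¹; rvac-good; rvac-involutive; rvac∘row)

  ∇∘row : ∀ {G} → IsFilter P G → ∇ P (row G) ≡ rowA P (∇ P G)
  ∇∘row G-filter = cong (∇ P) (row≡rowF G-filter)

  Δ∘Θ∘row : ∀ {G} → IsFilter P G → Δ P (Θ P (row G)) ≡ rowA P (Δ P (Θ P G))
  Δ∘Θ∘row {G} G-filter = begin
    Δ P (Θ P (row G))              ≡⟨ Δ∘Θ≡rowA⁻¹∘∇ _ (row-good G-filter) ⟩
    rowA⁻¹ P (∇ P (row G))         ≡⟨ cong (rowA⁻¹ P) (∇∘row G-filter) ⟩
    rowA⁻¹ P (rowA P (∇ P G))      ≡⟨ rowA⁻¹∘rowA _ (∇-antichain G) ⟩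
    ∇ P G                          ≡⟨ rowA∘rowA⁻¹ _ (∇-antichain G) ⟨
    rowA P (rowA⁻¹ P (∇ P G))      ≡⟨ cong (rowA P) (Δ∘Θ≡rowA⁻¹∘∇ G G-filter) ⟨
    rowA P (Δ P (Θ P G))           ∎
    where open ≡-Reasoning

  module Transport (f section : Subset n → Subset n)
    (f-antichain : ∀ {G} → IsFilter P G → IsAntichain P (f G))
    (section-filter : ∀ A → IsFilter P (section A))
    (f∘section : ∀ {A} → IsAntichain P A → f (section A) ≡ A)
    (f∘row : ∀ {G} → IsFilter P G → f (row G) ≡ rowA P (f G))
    (V W : Subset n → Subset n)
    (V-filter : ∀ {G} → IsFilter P G → IsFilter P (V G))
    (f∘V : ∀ {G} → IsFilter P G → f (V G) ≡ W (f G))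
    where

    f∘row⁻¹ : ∀ {H} → IsFilter P H → f (row⁻¹ H) ≡ rowA⁻¹ P (f H)
    f∘row⁻¹ {H} H-filter = sym (begin
      rowA⁻¹ P (f H)                   ≡⟨ cong (rowA⁻¹ P ∘ f) (row∘row⁻¹ H-filter) ⟨
      rowA⁻¹ P (f (row (row⁻¹ H)))     ≡⟨ cong (rowA⁻¹ P) (f∘row (row⁻¹-good H-filter)) ⟩
      rowA⁻¹ P (rowA P (f (row⁻¹ H)))  ≡⟨ rowA⁻¹∘rowA _ (f-antichain (row⁻¹-good H-filter)) ⟩
      f (row⁻¹ H)                      ∎)
      where open ≡-Reasoning

    W≡f∘V∘section : ∀ {A} → IsAntichain P A → W A ≡ f (V (section A))
    W≡f∘V∘section {A} A-antichain = trans (cong W (sym (f∘section A-antichain))) (sym (f∘V (section-filter A)))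

    W-antichain : ∀ {A} → IsAntichain P A → IsAntichain P (W A)
    W-antichain A-antichain =
      subst (IsAntichain P) (sym (W≡f∘V∘section A-antichain)) (f-antichain (V-filter (section-filter _)))

    W-involutive : (∀ {G} → IsFilter P G → V (V G) ≡ G) → ∀ {A} → IsAntichain P A → W (W A) ≡ A
    W-involutive V-involutive {A} A-antichain = begin
      W (W A)                          ≡⟨ cong W (W≡f∘V∘section A-antichain) ⟩
      W (f (V G))                      ≡⟨ f∘V (V-filter G-filter) ⟨
      f (V (V G))                      ≡⟨ cong f (V-involutive G-filter) ⟩
      f G                              ≡⟨ f∘section A-antichain ⟩
      A                                ∎
      where
        open ≡-Reasoning
        G = section A
        G-filter = section-filter A

    W∘rowA : (∀ {G} → IsFilter P G → V (row G) ≡ row⁻¹ (V G)) →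
             ∀ {A} → IsAntichain P A → W (rowA P A) ≡ rowA⁻¹ P (W A)
    W∘rowA V∘row {A} A-antichain = begin
      W (rowA P A)                     ≡⟨ cong (W ∘ rowA P) (f∘section A-antichain) ⟨
      W (rowA P (f G))                 ≡⟨ cong W (f∘row G-filter) ⟨
      W (f (row G))                    ≡⟨ f∘V (row-good G-filter) ⟨
      f (V (row G))                    ≡⟨ cong f (V∘row G-filter) ⟩
      f (row⁻¹ (V G))                  ≡⟨ f∘row⁻¹ (V-filter G-filter) ⟩
      rowA⁻¹ P (f (V G))               ≡⟨ cong (rowA⁻¹ P) (W≡f∘V∘section A-antichain) ⟨
      rowA⁻¹ P (W A)                   ∎
      where
        open ≡-Reasoning
        G = section A
        G-filter = section-filter A

  module ∇-Transport = Transport (∇ P) (∇⁻¹ P) (λ {G} _ → ∇-antichain G) ∇⁻¹-filter (∇∘∇⁻¹ _) ∇∘row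
    (rvacF P rk r) (rvacA P rk r) rvac-good ∇∘rvacF

  module Δ∘Θ-Transport = Transport (Δ P ∘ Θ P) (Θ P ∘ Δ⁻¹ P) (λ {G} _ → Δ-antichain (Θ P G))
    (Θ-ideal ∘ Δ⁻¹-ideal) (λ {A} A-antichain → trans (cong (Δ P) (∁-involutive _)) (Δ∘Δ⁻¹ A A-antichain)) Δ∘Θ∘row
    (rvacF* P rk r) (rvacA* P rk r) (Rvac*.rvac*To-good r) Δ∘Θ∘rvacF*

proposition2p17 :
    (n : ℕ) (P : FinitePoset n) (r : ℕ) (rk : Fin n → ℕ) → IsGraded P r rk →
    -- rowA⁻¹ = Δ ∘ Θ ∘ ∇⁻¹ is indeed the inverse of rowA on antichains
    ((A : Subset n) → IsAntichain P A →
        IsAntichain P (rowA P A) × IsAntichain P (rowA⁻¹ P A)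
        × rowA⁻¹ P (rowA P A) ≡ A × rowA P (rowA⁻¹ P A) ≡ A)
    -- ∇ ∘ row_F = row_A ∘ ∇
    × ((F : Subset n) → IsFilter P F → ∇ P (rowF P F) ≡ rowA P (∇ P F))
    -- ∇ ∘ rvac_F = rvac_A ∘ ∇
    × ((F : Subset n) → IsFilter P F → ∇ P (rvacF P rk r F) ≡ rvacA P rk r (∇ P F))
    -- (Δ ∘ Θ) ∘ rvac*_F = rvac*_A ∘ (Δ ∘ Θ)
    × ((F : Subset n) → IsFilter P F →
        Δ P (Θ P (rvacF* P rk r F)) ≡ rvacA* P rk r (Δ P (Θ P F)))
    -- Δ ∘ Θ = row_A⁻¹ ∘ ∇
    × ((F : Subset n) → IsFilter P F → Δ P (Θ P F) ≡ rowA⁻¹ P (∇ P F))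
    -- rvac_A and rvac*_A are involutions on antichains
    × ((A : Subset n) → IsAntichain P A →
        IsAntichain P (rvacA P rk r A) × rvacA P rk r (rvacA P rk r A) ≡ A)
    × ((A : Subset n) → IsAntichain P A →
        IsAntichain P (rvacA* P rk r A) × rvacA* P rk r (rvacA* P rk r A) ≡ A)
    -- rvac_A ∘ row_A = row_A⁻¹ ∘ rvac_A,  rvac*_A ∘ row_A = row_A⁻¹ ∘ rvac*_A
    × ((A : Subset n) → IsAntichain P A →
        rvacA P rk r (rowA P A) ≡ rowA⁻¹ P (rvacA P rk r A))
    × ((A : Subset n) → IsAntichain P A →
        rvacA* P rk r (rowA P A) ≡ rowA⁻¹ P (rvacA* P rk r A))
proposition2p17 n P r rk graded =
    (λ A A-antichain → ∇-antichain _ , Δ-antichain _ , rowA⁻¹∘rowA A A-antichain , rowA∘rowA⁻¹ A A-antichain)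
  , (λ F _ → refl)
  , (λ F → ∇∘rvacF)
  , (λ F → Δ∘Θ∘rvacF*)
  , Δ∘Θ≡rowA⁻¹∘∇
  , (λ A A-antichain → ∇-Transport.W-antichain A-antichain , ∇-Transport.W-involutive rvac-involutive A-antichain)
  , (λ A A-antichain → Δ∘Θ-Transport.W-antichain A-antichain
                     , Δ∘Θ-Transport.W-involutive (Rvac*.rvac*To-involutive r) A-antichain)
  , (λ A → ∇-Transport.W∘rowA rvac∘row)
  , (λ A → Δ∘Θ-Transport.W∘rowA (Rvac*.rvac*To∘ascendingTo r))
  where
    open Poset P
    open Equivariance P r rk graded
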